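{- For every map $f\colon A\to B$ of the theory $\mathbf{PR}$, $$\mathbf{PR}\vdash\ [\,a\doteq_A a'\,]\implies[\,f(a)\doteq_B f(a')\,]\colon A\times A\to\mathbb N,$$ i.e. this implication equals $\mathrm{true}_{A\times A}$ in $\mathbf{PR}$.
   Context: $\mathbf{PR}$ is the variable-free categorical theory of primitive recursion: objects generated from a terminal object $\mathbf 1$ and a natural numbers object $\mathbb N$ by binary products; maps generated from $0\colon\mathbf 1\to\mathbb N$, $\mathrm s\colon\mathbb N\to\mathbb N$, identities, composition, terminal maps, projections, induced maps $(f,g)$, and iterates $f^{\S}\colon A\times\mathbb N\to A$ of endomaps $f$; equations: category and cartesian axioms (including surjective pairing), $f^{\S}(a,0)=a$, $f^{\S}(a,\mathrm s n)=f(f^{\S}(a,n))$, and Freyd's uniqueness scheme for initialised iterates. Free variables $a,a'$ denote the two projections $A\times A\to A$. Truth values are $0=\mathrm{false}$, $1=\mathrm{true}$; $[m\doteq n]=\neg(m\dot-n)\wedge\neg(n\dot-m)$ on $\mathbb N$ (with $\neg$ the zero test and $x\wedge y=\mathrm{sign}(xy)$), extended componentwise to products and trivially to $\mathbf 1$; $[p\Rightarrow q]=\neg p\vee q$ with $x\vee y=\mathrm{sign}(x+y)$. -}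

module Defs where

infixr 6 _⊗_
infixr 9 _∘_
infix 4 _≈_

data Obj : Set where
  𝟙   : Obj
  ℕo  : Obj
  _⊗_ : Obj → Obj → Obj

data Hom : Obj → Obj → Set where
  id   : ∀ {A} → Hom A A
  _∘_  : ∀ {A B C} → Hom B C → Hom A B → Hom A C
  !    : ∀ {A} → Hom A 𝟙
  π₁   : ∀ {A B} → Hom (A ⊗ B) A
  π₂   : ∀ {A B} → Hom (A ⊗ B) B
  ⟨_,_⟩ : ∀ {A B C} → Hom C A → Hom C B → Hom C (A ⊗ B)
  zero : Hom 𝟙 ℕo
  succ : Hom ℕo ℕo
  iter : ∀ {A} → Hom A A → Hom (A ⊗ ℕo) A

data _≈_ : ∀ {A B} → Hom A B → Hom A B → Set where
  ≈-refl  : ∀ {A B} {f : Hom A B} → f ≈ f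
  ≈-sym   : ∀ {A B} {f g : Hom A B} → f ≈ g → g ≈ f
  ≈-trans : ∀ {A B} {f g h : Hom A B} → f ≈ g → g ≈ h → f ≈ h
  ∘-cong  : ∀ {A B C} {f f' : Hom B C} {g g' : Hom A B} →
            f ≈ f' → g ≈ g' → f ∘ g ≈ f' ∘ g'
  ⟨⟩-cong : ∀ {A B C} {f f' : Hom C A} {g g' : Hom C B} →
            f ≈ f' → g ≈ g' → ⟨ f , g ⟩ ≈ ⟨ f' , g' ⟩
  iter-cong : ∀ {A} {f f' : Hom A A} → f ≈ f' → iter f ≈ iter f'
  idˡ   : ∀ {A B} {f : Hom A B} → id ∘ f ≈ f
  idʳ   : ∀ {A B} {f : Hom A B} → f ∘ id ≈ f
  assoc : ∀ {A B C D} {f : Hom C D} {g : Hom B C} {h : Hom A B} →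
          (f ∘ g) ∘ h ≈ f ∘ (g ∘ h)
  !-unique : ∀ {A} {f : Hom A 𝟙} → f ≈ !
  π₁-β : ∀ {A B C} {f : Hom C A} {g : Hom C B} → π₁ ∘ ⟨ f , g ⟩ ≈ f
  π₂-β : ∀ {A B C} {f : Hom C A} {g : Hom C B} → π₂ ∘ ⟨ f , g ⟩ ≈ g
  ⟨⟩-η : ∀ {A B C} {h : Hom C (A ⊗ B)} → ⟨ π₁ ∘ h , π₂ ∘ h ⟩ ≈ h
  iter-zero : ∀ {A} {f : Hom A A} → iter f ∘ ⟨ id , zero ∘ ! ⟩ ≈ id
  iter-succ : ∀ {A} {f : Hom A A} →
              iter f ∘ ⟨ π₁ , succ ∘ π₂ ⟩ ≈ f ∘ iter f
  -- Freyd's uniqueness of initialised iterates: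
  -- g(a, s n) = f(g(a,n))  ⟹  g(a,n) = f^§(g(a,0), n)
  freyd : ∀ {A B} {g : Hom (A ⊗ ℕo) B} {f : Hom B B} →
          g ∘ ⟨ π₁ , succ ∘ π₂ ⟩ ≈ f ∘ g →
          g ≈ iter f ∘ ⟨ (g ∘ ⟨ id , zero ∘ ! ⟩) ∘ π₁ , π₂ ⟩

one : Hom 𝟙 ℕo
one = succ ∘ zero

true : ∀ {A} → Hom A ℕo
true = one ∘ !

pre : Hom ℕo ℕo
pre = π₁ ∘ iter ⟨ π₂ , succ ∘ π₂ ⟩ ∘ ⟨ ⟨ zero , zero ⟩ ∘ ! , id ⟩

monus : Hom (ℕo ⊗ ℕo) ℕo
monus = iter pre

add : Hom (ℕo ⊗ ℕo) ℕo
add = iter succ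

mul : Hom (ℕo ⊗ ℕo) ℕo
mul = π₂ ∘ iter ⟨ π₁ , add ∘ ⟨ π₂ , π₁ ⟩ ⟩ ∘ ⟨ ⟨ π₁ , zero ∘ ! ⟩ , π₂ ⟩

neg : Hom ℕo ℕo
neg = monus ∘ ⟨ one ∘ ! , id ⟩

sign : Hom ℕo ℕo
sign = neg ∘ neg

and : Hom (ℕo ⊗ ℕo) ℕo
and = sign ∘ mul

or : Hom (ℕo ⊗ ℕo) ℕo
or = sign ∘ add

imp : Hom (ℕo ⊗ ℕo) ℕo
imp = or ∘ ⟨ neg ∘ π₁ , π₂ ⟩

eq : (A : Obj) → Hom (A ⊗ A) ℕo
eq 𝟙       = true
eq ℕo      = and ∘ ⟨ neg ∘ monus , neg ∘ monus ∘ ⟨ π₂ , π₁ ⟩ ⟩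
eq (A ⊗ B) = and ∘ ⟨ eq A ∘ ⟨ π₁ ∘ π₁ , π₁ ∘ π₂ ⟩ , eq B ∘ ⟨ π₂ ∘ π₁ , π₂ ∘ π₂ ⟩ ⟩

_×₁_ : ∀ {A B C D} → Hom A B → Hom C D → Hom (A ⊗ C) (B ⊗ D)
f ×₁ g = ⟨ f ∘ π₁ , g ∘ π₂ ⟩

module Submission where

-- Identities,
-- composition, terminal maps, projections and pairing reduce to rules of
-- propositional logic for truth values, which are justified by a verified
-- truth-table check; zero and successor are direct computations.  The
-- substance is the iterate F = g^§:
--  * with the count m fixed, [a ≐ a'] ⇒ [F(a, m) ≐ F(a', m)] follows by
--    induction on m, an induction principle derived from Freyd's scheme;
--  * varying the count uses Leibniz's law for numbers, proved by writing
--    m = (m ∸ m') + c and m' = (m' ∸ m) + c for a common part c of m, m'.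

open import Defs
open import Data.Nat using (ℕ) renaming (zero to nzero ; suc to nsuc)
open import Data.Fin using (Fin) renaming (zero to fz ; suc to fs)
open import Data.Bool using (Bool ; T ; if_then_else_) renaming (true to tt ; false to ff ; _∧_ to _&&_)
open import Relation.Binary.PropositionalEquality using (_≡_ ; refl)
open import Data.Product using (Σ ; _×_ ; _,_)
open import Level using (0ℓ)
open import Relation.Binary.Bundles using (Setoid)
import Relation.Binary.Reasoning.Setoid as SetoidReasoning

hom-setoid : Obj → Obj → Setoid 0ℓ 0ℓ
hom-setoid A B = record
  { Carrier       = Hom A B
  ; _≈_           = _≈_
  ; isEquivalence = record { refl = ≈-refl ; sym = ≈-sym ; trans = ≈-trans }
  }

module HomReasoning {A B : Obj} = SetoidReasoning (hom-setoid A B)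
open HomReasoning using (begin_ ; _∎ ; step-≈-⟩ ; step-≈-⟨)

∘-congˡ : ∀ {A B C} {f f' : Hom B C} {g : Hom A B} → f ≈ f' → f ∘ g ≈ f' ∘ g
∘-congˡ p = ∘-cong p ≈-refl

∘-congʳ : ∀ {A B C} {f : Hom B C} {g g' : Hom A B} → g ≈ g' → f ∘ g ≈ f ∘ g'
∘-congʳ p = ∘-cong ≈-refl p

⟨⟩-congˡ : ∀ {A B C} {f f' : Hom C A} {g : Hom C B} → f ≈ f' → ⟨ f , g ⟩ ≈ ⟨ f' , g ⟩
⟨⟩-congˡ p = ⟨⟩-cong p ≈-refl

⟨⟩-congʳ : ∀ {A B C} {f : Hom C A} {g g' : Hom C B} → g ≈ g' → ⟨ f , g ⟩ ≈ ⟨ f , g' ⟩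
⟨⟩-congʳ p = ⟨⟩-cong ≈-refl p

arg-cong : ∀ {A B C D} {F : Hom (A ⊗ B) D} {x x' : Hom C A} {y y' : Hom C B} →
           x ≈ x' → y ≈ y' → F ∘ ⟨ x , y ⟩ ≈ F ∘ ⟨ x' , y' ⟩
arg-cong p q = ∘-congʳ (⟨⟩-cong p q)

argˡ-cong : ∀ {A B C D} {F : Hom (A ⊗ B) D} {x x' : Hom C A} {y : Hom C B} →
            x ≈ x' → F ∘ ⟨ x , y ⟩ ≈ F ∘ ⟨ x' , y ⟩
argˡ-cong p = arg-cong p ≈-refl

argʳ-cong : ∀ {A B C D} {F : Hom (A ⊗ B) D} {x : Hom C A} {y y' : Hom C B} →
            y ≈ y' → F ∘ ⟨ x , y ⟩ ≈ F ∘ ⟨ x , y' ⟩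
argʳ-cong q = arg-cong ≈-refl q

sym-assoc : ∀ {A B C D} {f : Hom C D} {g : Hom B C} {h : Hom A B} →
            f ∘ (g ∘ h) ≈ (f ∘ g) ∘ h
sym-assoc = ≈-sym assoc

⟨⟩∘ : ∀ {A B C D} {f : Hom C A} {g : Hom C B} {h : Hom D C} →
      ⟨ f , g ⟩ ∘ h ≈ ⟨ f ∘ h , g ∘ h ⟩
⟨⟩∘ = ≈-trans (≈-sym ⟨⟩-η)
  (⟨⟩-cong (≈-trans sym-assoc (∘-congˡ π₁-β)) (≈-trans sym-assoc (∘-congˡ π₂-β)))

app-∘ : ∀ {A B C D E} {F : Hom (A ⊗ B) C} {a : Hom D A} {b : Hom D B} {h : Hom E D} →
        (F ∘ ⟨ a , b ⟩) ∘ h ≈ F ∘ ⟨ a ∘ h , b ∘ h ⟩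
app-∘ = ≈-trans assoc (∘-congʳ ⟨⟩∘)

π₁-β∘ : ∀ {A B C D} {f : Hom C A} {g : Hom C B} {h : Hom D C} →
        π₁ ∘ (⟨ f , g ⟩ ∘ h) ≈ f ∘ h
π₁-β∘ = ≈-trans sym-assoc (∘-congˡ π₁-β)

π₂-β∘ : ∀ {A B C D} {f : Hom C A} {g : Hom C B} {h : Hom D C} →
        π₂ ∘ (⟨ f , g ⟩ ∘ h) ≈ g ∘ h
π₂-β∘ = ≈-trans sym-assoc (∘-congˡ π₂-β)

∘π₁-β : ∀ {A B C D} {f : Hom A D} {x : Hom C A} {n : Hom C B} → (f ∘ π₁) ∘ ⟨ x , n ⟩ ≈ f ∘ x
∘π₁-β = ≈-trans assoc (∘-congʳ π₁-β)

∘π₂-β : ∀ {A B C D} {f : Hom B D} {x : Hom C A} {n : Hom C B} → (f ∘ π₂) ∘ ⟨ x , n ⟩ ≈ f ∘ n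
∘π₂-β = ≈-trans assoc (∘-congʳ π₂-β)

⟨π₁,π₂⟩≈id : ∀ {A B} → ⟨ π₁ {A} {B} , π₂ ⟩ ≈ id
⟨π₁,π₂⟩≈id = ≈-trans (⟨⟩-cong (≈-sym idʳ) (≈-sym idʳ)) ⟨⟩-η

×₁-∘⟨⟩ : ∀ {A B C D E} {f : Hom A B} {g : Hom C D} {a : Hom E A} {b : Hom E C} →
         (f ×₁ g) ∘ ⟨ a , b ⟩ ≈ ⟨ f ∘ a , g ∘ b ⟩
×₁-∘⟨⟩ = ≈-trans ⟨⟩∘ (⟨⟩-cong ∘π₁-β ∘π₂-β)

const-∘ : ∀ {Γ Δ B} {c : Hom 𝟙 B} {h : Hom Δ Γ} → (c ∘ !) ∘ h ≈ c ∘ !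
const-∘ = ≈-trans assoc (∘-congʳ (≈-trans !-unique (≈-sym !-unique)))

-- The truth values; false is also the numeral 0 and true the numeral 1.
false : ∀ {Γ} → Hom Γ ℕo
false = zero ∘ !

true≈succ-false : ∀ {Γ} → true {Γ} ≈ succ ∘ false
true≈succ-false = assoc

-- Iteration.  A map  g : X × ℕ → B  is determined by its restrictions
-- along  σ₀ = (x ↦ (x, 0))  and  σₛ = ((x, n) ↦ (x, s n)).

σ₀ : ∀ {X} → Hom X (X ⊗ ℕo)
σ₀ = ⟨ id , false ⟩

σₛ : ∀ {X} → Hom (X ⊗ ℕo) (X ⊗ ℕo)
σₛ = ⟨ π₁ , succ ∘ π₂ ⟩

σ₀∘ : ∀ {X Y} {x : Hom Y X} → σ₀ ∘ x ≈ ⟨ x , false ⟩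
σ₀∘ = ≈-trans ⟨⟩∘ (⟨⟩-cong idˡ const-∘)

σₛ∘ : ∀ {X Y} {x : Hom Y X} {n : Hom Y ℕo} → σₛ ∘ ⟨ x , n ⟩ ≈ ⟨ x , succ ∘ n ⟩
σₛ∘ = ≈-trans ⟨⟩∘ (⟨⟩-cong π₁-β ∘π₂-β)

×₁id-σ₀ : ∀ {A B} {f : Hom A B} → (f ×₁ id) ∘ σ₀ ≈ σ₀ ∘ f
×₁id-σ₀ = ≈-trans ×₁-∘⟨⟩ (≈-sym (≈-trans σ₀∘ (⟨⟩-cong (≈-sym idʳ) (≈-sym idˡ))))

×₁id-σₛ : ∀ {A B} {f : Hom A B} → (f ×₁ id) ∘ σₛ ≈ σₛ ∘ (f ×₁ id)
×₁id-σₛ = ≈-trans ×₁-∘⟨⟩ (≈-sym (≈-trans σₛ∘ (⟨⟩-congʳ (≈-trans (∘-congʳ idˡ) (≈-sym idˡ)))))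

iter-β₀ : ∀ {Γ A} {f : Hom A A} {a : Hom Γ A} → iter f ∘ ⟨ a , false ⟩ ≈ a
iter-β₀ {f = f} {a} = begin
  iter f ∘ ⟨ a , false ⟩ ≈⟨ ∘-congʳ σ₀∘ ⟨
  iter f ∘ (σ₀ ∘ a)      ≈⟨ sym-assoc ⟩
  (iter f ∘ σ₀) ∘ a      ≈⟨ ∘-congˡ iter-zero ⟩
  id ∘ a                 ≈⟨ idˡ ⟩
  a                      ∎

iter-βₛ : ∀ {Γ A} {f : Hom A A} {a : Hom Γ A} {n : Hom Γ ℕo} →
          iter f ∘ ⟨ a , succ ∘ n ⟩ ≈ f ∘ (iter f ∘ ⟨ a , n ⟩)
iter-βₛ {f = f} {a} {n} = begin
  iter f ∘ ⟨ a , succ ∘ n ⟩    ≈⟨ ∘-congʳ σₛ∘ ⟨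
  iter f ∘ (σₛ ∘ ⟨ a , n ⟩)    ≈⟨ sym-assoc ⟩
  (iter f ∘ σₛ) ∘ ⟨ a , n ⟩    ≈⟨ ∘-congˡ iter-succ ⟩
  (f ∘ iter f) ∘ ⟨ a , n ⟩     ≈⟨ assoc ⟩
  f ∘ (iter f ∘ ⟨ a , n ⟩)     ∎

iter-unique : ∀ {X B} {g h : Hom (X ⊗ ℕo) B} {f : Hom B B} →
              g ∘ σₛ ≈ f ∘ g → h ∘ σₛ ≈ f ∘ h → g ∘ σ₀ ≈ h ∘ σ₀ → g ≈ h
iter-unique pg ph p0 =
  ≈-trans (freyd pg) (≈-trans (argˡ-cong (∘-congˡ p0)) (≈-sym (freyd ph)))

-- Proof: ⟨id, h⟩ and ⟨id, k⟩ satisfy the same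
-- recursion step (which reads off the successor values) and agree at 0.
by-cases : ∀ {X B} {h k : Hom (X ⊗ ℕo) B} →
           h ∘ σ₀ ≈ k ∘ σ₀ → h ∘ σₛ ≈ k ∘ σₛ → h ≈ k
by-cases {X} {B} {h} {k} p0 ps = begin
  h               ≈⟨ π₂-β ⟨
  π₂ ∘ ⟨ id , h ⟩ ≈⟨ ∘-congʳ graphs ⟩
  π₂ ∘ ⟨ id , k ⟩ ≈⟨ π₂-β ⟩
  k               ∎
  where
  step : Hom (X ⊗ ℕo) B → Hom ((X ⊗ ℕo) ⊗ B) ((X ⊗ ℕo) ⊗ B)
  step m = ⟨ σₛ ∘ π₁ , (m ∘ σₛ) ∘ π₁ ⟩
  graph-step : ∀ (m : Hom (X ⊗ ℕo) B) → ⟨ id , m ⟩ ∘ σₛ ≈ step m ∘ ⟨ id , m ⟩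
  graph-step m = ≈-trans ⟨⟩∘ (≈-sym (≈-trans ⟨⟩∘
    (⟨⟩-cong (≈-trans ∘π₁-β (≈-trans idʳ (≈-sym idˡ))) (≈-trans ∘π₁-β idʳ))))
  graphs : ⟨ id , h ⟩ ≈ ⟨ id , k ⟩
  graphs = iter-unique (graph-step h)
    (≈-trans (graph-step k) (∘-congˡ (⟨⟩-congʳ (∘-congˡ (≈-sym ps)))))
    (≈-trans ⟨⟩∘ (≈-trans (⟨⟩-congʳ p0) (≈-sym ⟨⟩∘)))

iter-natural : ∀ {S B} {st : Hom S S} {I : Hom S B} {T : Hom B B} →
               I ∘ st ≈ T ∘ I → I ∘ iter st ≈ iter T ∘ (I ×₁ id)
iter-natural {st = st} {I} {T} p = iter-unique stepˡ stepʳ start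
  where
  stepˡ : (I ∘ iter st) ∘ σₛ ≈ T ∘ (I ∘ iter st)
  stepˡ = begin
    (I ∘ iter st) ∘ σₛ ≈⟨ assoc ⟩
    I ∘ (iter st ∘ σₛ) ≈⟨ ∘-congʳ iter-succ ⟩
    I ∘ (st ∘ iter st) ≈⟨ sym-assoc ⟩
    (I ∘ st) ∘ iter st ≈⟨ ∘-congˡ p ⟩
    (T ∘ I) ∘ iter st  ≈⟨ assoc ⟩
    T ∘ (I ∘ iter st)  ∎
  stepʳ : (iter T ∘ (I ×₁ id)) ∘ σₛ ≈ T ∘ (iter T ∘ (I ×₁ id))
  stepʳ = begin
    (iter T ∘ (I ×₁ id)) ∘ σₛ ≈⟨ assoc ⟩
    iter T ∘ ((I ×₁ id) ∘ σₛ) ≈⟨ ∘-congʳ ×₁id-σₛ ⟩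
    iter T ∘ (σₛ ∘ (I ×₁ id)) ≈⟨ sym-assoc ⟩
    (iter T ∘ σₛ) ∘ (I ×₁ id) ≈⟨ ∘-congˡ iter-succ ⟩
    (T ∘ iter T) ∘ (I ×₁ id)  ≈⟨ assoc ⟩
    T ∘ (iter T ∘ (I ×₁ id))  ∎
  start : (I ∘ iter st) ∘ σ₀ ≈ (iter T ∘ (I ×₁ id)) ∘ σ₀
  start = begin
    (I ∘ iter st) ∘ σ₀        ≈⟨ assoc ⟩
    I ∘ (iter st ∘ σ₀)        ≈⟨ ∘-congʳ iter-zero ⟩
    I ∘ id                    ≈⟨ idʳ ⟩
    I                         ≈⟨ iter-β₀ ⟨
    iter T ∘ ⟨ I , false ⟩    ≈⟨ ∘-congʳ (≈-trans ×₁id-σ₀ σ₀∘) ⟨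
    iter T ∘ ((I ×₁ id) ∘ σ₀) ≈⟨ sym-assoc ⟩
    (iter T ∘ (I ×₁ id)) ∘ σ₀ ∎

iter-invariant : ∀ {S B} {st : Hom S S} {I : Hom S B} →
                 I ∘ st ≈ I → I ∘ iter st ≈ I ∘ π₁
iter-invariant {st = st} {I} p = iter-unique stepˡ stepʳ start
  where
  stepˡ : (I ∘ iter st) ∘ σₛ ≈ id ∘ (I ∘ iter st)
  stepˡ = ≈-trans assoc (≈-trans (∘-congʳ iter-succ)
            (≈-trans sym-assoc (≈-trans (∘-congˡ p) (≈-sym idˡ))))
  stepʳ : (I ∘ π₁) ∘ σₛ ≈ id ∘ (I ∘ π₁)
  stepʳ = ≈-trans ∘π₁-β (≈-sym idˡ)
  start : (I ∘ iter st) ∘ σ₀ ≈ (I ∘ π₁) ∘ σ₀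
  start = ≈-trans assoc (≈-trans (∘-congʳ iter-zero) (≈-trans idʳ (≈-sym (≈-trans ∘π₁-β idʳ))))

-- Identities needing induction are first proved
-- for generic variables (projections) by Freyd uniqueness and then
-- instantiated.

add-zeroʳ : ∀ {Γ} {x : Hom Γ ℕo} → add ∘ ⟨ x , false ⟩ ≈ x
add-zeroʳ = iter-β₀

add-succʳ : ∀ {Γ} {x n : Hom Γ ℕo} → add ∘ ⟨ x , succ ∘ n ⟩ ≈ succ ∘ (add ∘ ⟨ x , n ⟩)
add-succʳ = iter-βₛ

monus-zeroʳ : ∀ {Γ} {x : Hom Γ ℕo} → monus ∘ ⟨ x , false ⟩ ≈ x
monus-zeroʳ = iter-β₀

monus-succʳ : ∀ {Γ} {x n : Hom Γ ℕo} → monus ∘ ⟨ x , succ ∘ n ⟩ ≈ pre ∘ (monus ∘ ⟨ x , n ⟩)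
monus-succʳ = iter-βₛ

add-zeroˡ : ∀ {Γ} {n : Hom Γ ℕo} → add ∘ ⟨ false , n ⟩ ≈ n
add-zeroˡ {n = n} = begin
  add ∘ ⟨ false , n ⟩                                 ≈⟨ arg-cong const-∘ π₂-β ⟨
  add ∘ ⟨ false ∘ ⟨ ! , n ⟩ , π₂ ∘ ⟨ ! , n ⟩ ⟩         ≈⟨ app-∘ ⟨
  (add ∘ ⟨ false , π₂ ⟩) ∘ ⟨ ! , n ⟩                   ≈⟨ ∘-congˡ generic ⟩
  π₂ ∘ ⟨ ! , n ⟩                                      ≈⟨ π₂-β ⟩
  n                                                   ∎
  where
  generic : add ∘ ⟨ false , π₂ ⟩ ≈ π₂ {𝟙} {ℕo}
  generic = iter-unique {f = succ}
    (≈-trans app-∘ (≈-trans (arg-cong const-∘ π₂-β) add-succʳ))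
    π₂-β
    (≈-trans app-∘ (≈-trans (arg-cong const-∘ π₂-β) (≈-trans add-zeroʳ (≈-sym π₂-β))))

add-succˡ : ∀ {Γ} {x n : Hom Γ ℕo} → add ∘ ⟨ succ ∘ x , n ⟩ ≈ succ ∘ (add ∘ ⟨ x , n ⟩)
add-succˡ {x = x} {n} = begin
  add ∘ ⟨ succ ∘ x , n ⟩                                  ≈⟨ arg-cong ∘π₁-β π₂-β ⟨
  add ∘ ⟨ (succ ∘ π₁) ∘ ⟨ x , n ⟩ , π₂ ∘ ⟨ x , n ⟩ ⟩      ≈⟨ app-∘ ⟨
  (add ∘ ⟨ succ ∘ π₁ , π₂ ⟩) ∘ ⟨ x , n ⟩                  ≈⟨ ∘-congˡ generic ⟩
  (succ ∘ add) ∘ ⟨ x , n ⟩                                ≈⟨ assoc ⟩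
  succ ∘ (add ∘ ⟨ x , n ⟩)                                ∎
  where
  generic : add ∘ ⟨ succ ∘ π₁ , π₂ ⟩ ≈ succ ∘ add
  generic = iter-unique {f = succ}
    (≈-trans app-∘ (≈-trans (arg-cong ∘π₁-β π₂-β) add-succʳ))
    (≈-trans assoc (∘-congʳ iter-succ))
    (≈-trans app-∘ (≈-trans (arg-cong ∘π₁-β π₂-β)
      (≈-trans add-zeroʳ (≈-sym (≈-trans assoc (∘-congʳ iter-zero))))))

-- The predecessor: pre iterates  (x, y) ↦ (y, s y)  from (0, 0), whose
-- second component just counts the steps.
module Predecessor where
  private
    shift : Hom (ℕo ⊗ ℕo) (ℕo ⊗ ℕo)
    shift = ⟨ π₂ , succ ∘ π₂ ⟩

    origin : Hom 𝟙 (ℕo ⊗ ℕo)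
    origin = ⟨ zero , zero ⟩

    run : ∀ {Γ} → Hom Γ ℕo → Hom Γ (ℕo ⊗ ℕo)
    run n = iter shift ∘ ⟨ origin ∘ ! , n ⟩

    pre-run : ∀ {Γ} {n : Hom Γ ℕo} → pre ∘ n ≈ π₁ ∘ run n
    pre-run = ≈-trans assoc (∘-congʳ (≈-trans app-∘ (arg-cong const-∘ idˡ)))

    counter : ∀ {Γ} {n : Hom Γ ℕo} → π₂ ∘ run n ≈ n
    counter {n = n} = begin
      π₂ ∘ run n                                 ≈⟨ sym-assoc ⟩
      (π₂ ∘ iter shift) ∘ ⟨ origin ∘ ! , n ⟩     ≈⟨ ∘-congˡ (iter-natural π₂-β) ⟩
      (add ∘ (π₂ ×₁ id)) ∘ ⟨ origin ∘ ! , n ⟩    ≈⟨ assoc ⟩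
      add ∘ ((π₂ ×₁ id) ∘ ⟨ origin ∘ ! , n ⟩)    ≈⟨ ∘-congʳ ×₁-∘⟨⟩ ⟩
      add ∘ ⟨ π₂ ∘ (origin ∘ !) , id ∘ n ⟩       ≈⟨ arg-cong (≈-trans sym-assoc (∘-congˡ π₂-β)) idˡ ⟩
      add ∘ ⟨ false , n ⟩                        ≈⟨ add-zeroˡ ⟩
      n                                          ∎

  pre-succ : ∀ {Γ} {n : Hom Γ ℕo} → pre ∘ (succ ∘ n) ≈ n
  pre-succ {n = n} = begin
    pre ∘ (succ ∘ n)            ≈⟨ pre-run ⟩
    π₁ ∘ run (succ ∘ n)         ≈⟨ ∘-congʳ iter-βₛ ⟩
    π₁ ∘ (shift ∘ run n)        ≈⟨ π₁-β∘ ⟩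
    π₂ ∘ run n                  ≈⟨ counter ⟩
    n                           ∎

  pre-zero : ∀ {Γ} → pre ∘ false {Γ} ≈ false
  pre-zero = ≈-trans pre-run (≈-trans (∘-congʳ iter-β₀) π₁-β∘)

open Predecessor

monus-zeroˡ : ∀ {Γ} {n : Hom Γ ℕo} → monus ∘ ⟨ false , n ⟩ ≈ false
monus-zeroˡ {n = n} = begin
  monus ∘ ⟨ false , n ⟩                               ≈⟨ arg-cong const-∘ π₂-β ⟨
  monus ∘ ⟨ false ∘ ⟨ ! , n ⟩ , π₂ ∘ ⟨ ! , n ⟩ ⟩       ≈⟨ app-∘ ⟨
  (monus ∘ ⟨ false , π₂ ⟩) ∘ ⟨ ! , n ⟩                 ≈⟨ ∘-congˡ generic ⟩
  false ∘ ⟨ ! , n ⟩                                   ≈⟨ const-∘ ⟩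
  false                                               ∎
  where
  generic : monus ∘ ⟨ false , π₂ ⟩ ≈ false {𝟙 ⊗ ℕo}
  generic = iter-unique {f = pre}
    (≈-trans app-∘ (≈-trans (arg-cong const-∘ π₂-β) monus-succʳ))
    (≈-trans const-∘ (≈-sym pre-zero))
    (≈-trans app-∘ (≈-trans (arg-cong const-∘ π₂-β) (≈-trans monus-zeroʳ (≈-sym const-∘))))

monus-succ-succ : ∀ {Γ} {x n : Hom Γ ℕo} → monus ∘ ⟨ succ ∘ x , succ ∘ n ⟩ ≈ monus ∘ ⟨ x , n ⟩
monus-succ-succ {x = x} {n} = begin
  monus ∘ ⟨ succ ∘ x , succ ∘ n ⟩                                 ≈⟨ arg-cong ∘π₁-β ∘π₂-β ⟨
  monus ∘ ⟨ (succ ∘ π₁) ∘ ⟨ x , n ⟩ , (succ ∘ π₂) ∘ ⟨ x , n ⟩ ⟩   ≈⟨ app-∘ ⟨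
  (monus ∘ ⟨ succ ∘ π₁ , succ ∘ π₂ ⟩) ∘ ⟨ x , n ⟩                 ≈⟨ ∘-congˡ generic ⟩
  monus ∘ ⟨ x , n ⟩                                               ∎
  where
  shifted : ∀ {Δ} {a m : Hom Δ ℕo} →
            (monus ∘ ⟨ succ ∘ π₁ , succ ∘ π₂ ⟩) ∘ ⟨ a , m ⟩ ≈ monus ∘ ⟨ succ ∘ a , succ ∘ m ⟩
  shifted = ≈-trans app-∘ (arg-cong ∘π₁-β ∘π₂-β)
  generic : monus ∘ ⟨ succ ∘ π₁ , succ ∘ π₂ ⟩ ≈ monus
  generic = iter-unique {f = pre}
    (≈-trans shifted monus-succʳ)
    iter-succ
    (≈-trans shifted (≈-trans monus-succʳ (≈-trans (∘-congʳ monus-zeroʳ)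
      (≈-trans pre-succ (≈-sym iter-zero)))))

monus-add : ∀ {Γ} {x y : Hom Γ ℕo} → monus ∘ ⟨ add ∘ ⟨ x , y ⟩ , y ⟩ ≈ x
monus-add {x = x} {y} = begin
  monus ∘ ⟨ add ∘ ⟨ x , y ⟩ , y ⟩                 ≈⟨ argʳ-cong π₂-β ⟨
  monus ∘ ⟨ add ∘ ⟨ x , y ⟩ , π₂ ∘ ⟨ x , y ⟩ ⟩    ≈⟨ app-∘ ⟨
  (monus ∘ ⟨ add , π₂ ⟩) ∘ ⟨ x , y ⟩              ≈⟨ ∘-congˡ generic ⟩
  π₁ ∘ ⟨ x , y ⟩                                  ≈⟨ π₁-β ⟩
  x                                               ∎
  where
  generic : monus ∘ ⟨ add , π₂ ⟩ ≈ π₁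
  generic = iter-unique {f = id}
    (≈-trans app-∘ (≈-trans (arg-cong iter-succ π₂-β) (≈-trans monus-succ-succ (≈-sym idˡ))))
    (≈-trans π₁-β (≈-sym idˡ))
    (≈-trans app-∘ (≈-trans (arg-cong iter-zero π₂-β) (≈-trans monus-zeroʳ (≈-sym π₁-β))))

-- Multiplication iterates  (m, acc) ↦ (m, acc + m)  from (m, 0); the
-- first component is invariant.
module Multiplication where
  private
    accumulate : Hom (ℕo ⊗ ℕo) (ℕo ⊗ ℕo)
    accumulate = ⟨ π₁ , add ∘ ⟨ π₂ , π₁ ⟩ ⟩

    run : ∀ {Γ} → Hom Γ ℕo → Hom Γ ℕo → Hom Γ (ℕo ⊗ ℕo)
    run x n = iter accumulate ∘ ⟨ ⟨ x , false ⟩ , n ⟩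

    mul-run : ∀ {Γ} {x n : Hom Γ ℕo} → mul ∘ ⟨ x , n ⟩ ≈ π₂ ∘ run x n
    mul-run = ≈-trans assoc (∘-congʳ (≈-trans app-∘ (arg-cong (≈-trans ⟨⟩∘ (⟨⟩-cong π₁-β const-∘)) π₂-β)))

    factor : ∀ {Γ} {x n : Hom Γ ℕo} → π₁ ∘ run x n ≈ x
    factor = ≈-trans sym-assoc (≈-trans (∘-congˡ (iter-invariant π₁-β))
               (≈-trans assoc (≈-trans (∘-congʳ π₁-β) π₁-β)))

  mul-zeroʳ : ∀ {Γ} {x : Hom Γ ℕo} → mul ∘ ⟨ x , false ⟩ ≈ false
  mul-zeroʳ = ≈-trans mul-run (≈-trans (∘-congʳ iter-β₀) π₂-β)

  mul-succʳ : ∀ {Γ} {x n : Hom Γ ℕo} → mul ∘ ⟨ x , succ ∘ n ⟩ ≈ add ∘ ⟨ mul ∘ ⟨ x , n ⟩ , x ⟩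
  mul-succʳ {x = x} {n} = begin
    mul ∘ ⟨ x , succ ∘ n ⟩                    ≈⟨ mul-run ⟩
    π₂ ∘ run x (succ ∘ n)                     ≈⟨ ∘-congʳ iter-βₛ ⟩
    π₂ ∘ (accumulate ∘ run x n)               ≈⟨ π₂-β∘ ⟩
    (add ∘ ⟨ π₂ , π₁ ⟩) ∘ run x n             ≈⟨ app-∘ ⟩
    add ∘ ⟨ π₂ ∘ run x n , π₁ ∘ run x n ⟩     ≈⟨ arg-cong (≈-sym mul-run) factor ⟩
    add ∘ ⟨ mul ∘ ⟨ x , n ⟩ , x ⟩             ∎

open Multiplication

mul-zeroˡ : ∀ {Γ} {n : Hom Γ ℕo} → mul ∘ ⟨ false , n ⟩ ≈ false
mul-zeroˡ {n = n} = begin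
  mul ∘ ⟨ false , n ⟩                               ≈⟨ arg-cong const-∘ π₂-β ⟨
  mul ∘ ⟨ false ∘ ⟨ ! , n ⟩ , π₂ ∘ ⟨ ! , n ⟩ ⟩       ≈⟨ app-∘ ⟨
  (mul ∘ ⟨ false , π₂ ⟩) ∘ ⟨ ! , n ⟩                 ≈⟨ ∘-congˡ generic ⟩
  false ∘ ⟨ ! , n ⟩                                 ≈⟨ const-∘ ⟩
  false                                             ∎
  where
  generic : mul ∘ ⟨ false , π₂ ⟩ ≈ false {𝟙 ⊗ ℕo}
  generic = iter-unique {f = id}
    (≈-trans app-∘ (≈-trans (arg-cong const-∘ π₂-β)
      (≈-trans mul-succʳ (≈-trans add-zeroʳ (≈-sym idˡ)))))
    (≈-trans const-∘ (≈-sym idˡ))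
    (≈-trans app-∘ (≈-trans (arg-cong const-∘ π₂-β) (≈-trans mul-zeroʳ (≈-sym const-∘))))

mul-oneˡ : ∀ {Γ} {n : Hom Γ ℕo} → mul ∘ ⟨ true , n ⟩ ≈ n
mul-oneˡ {n = n} = begin
  mul ∘ ⟨ true , n ⟩                                ≈⟨ arg-cong const-∘ π₂-β ⟨
  mul ∘ ⟨ true ∘ ⟨ ! , n ⟩ , π₂ ∘ ⟨ ! , n ⟩ ⟩        ≈⟨ app-∘ ⟨
  (mul ∘ ⟨ true , π₂ ⟩) ∘ ⟨ ! , n ⟩                  ≈⟨ ∘-congˡ generic ⟩
  π₂ ∘ ⟨ ! , n ⟩                                    ≈⟨ π₂-β ⟩
  n                                                 ∎
  where
  generic : mul ∘ ⟨ true , π₂ ⟩ ≈ π₂ {𝟙} {ℕo}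
  generic = iter-unique {f = succ}
    (≈-trans app-∘ (≈-trans (arg-cong const-∘ π₂-β) (≈-trans mul-succʳ
      (≈-trans (argʳ-cong true≈succ-false) (≈-trans add-succʳ (∘-congʳ add-zeroʳ))))))
    π₂-β
    (≈-trans app-∘ (≈-trans (arg-cong const-∘ π₂-β) (≈-trans mul-zeroʳ (≈-sym π₂-β))))

mul-oneʳ : ∀ {Γ} {n : Hom Γ ℕo} → mul ∘ ⟨ n , true ⟩ ≈ n
mul-oneʳ = ≈-trans (argʳ-cong true≈succ-false)
  (≈-trans mul-succʳ (≈-trans (argˡ-cong mul-zeroʳ) add-zeroˡ))

neg-unfold : ∀ {Γ} {x : Hom Γ ℕo} → neg ∘ x ≈ monus ∘ ⟨ true , x ⟩
neg-unfold = ≈-trans app-∘ (arg-cong const-∘ idˡ)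

neg-zero : ∀ {Γ} → neg ∘ false {Γ} ≈ true
neg-zero = ≈-trans neg-unfold monus-zeroʳ

neg-succ : ∀ {Γ} {x : Hom Γ ℕo} → neg ∘ (succ ∘ x) ≈ false
neg-succ = ≈-trans neg-unfold (≈-trans (argˡ-cong true≈succ-false)
  (≈-trans monus-succ-succ monus-zeroˡ))

neg-true : ∀ {Γ} → neg ∘ true {Γ} ≈ false
neg-true = ≈-trans (∘-congʳ true≈succ-false) neg-succ

sign-zero : ∀ {Γ} → sign ∘ false {Γ} ≈ false
sign-zero = ≈-trans assoc (≈-trans (∘-congʳ neg-zero) neg-true)

sign-succ : ∀ {Γ} {x : Hom Γ ℕo} → sign ∘ (succ ∘ x) ≈ true
sign-succ = ≈-trans assoc (≈-trans (∘-congʳ neg-succ) neg-zero)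

sign-true : ∀ {Γ} → sign ∘ true {Γ} ≈ true
sign-true = ≈-trans (∘-congʳ true≈succ-false) sign-succ

unary-by-cases : (u v : Hom ℕo ℕo) → u ∘ false {𝟙} ≈ v ∘ false →
                 u ∘ (succ ∘ π₂) ≈ v ∘ (succ ∘ π₂ {𝟙}) → ∀ {Γ} {x : Hom Γ ℕo} → u ∘ x ≈ v ∘ x
unary-by-cases u v at-zero at-succ {x = x} = begin
  u ∘ x                      ≈⟨ ∘π₂-β ⟨
  (u ∘ π₂) ∘ ⟨ ! , x ⟩       ≈⟨ ∘-congˡ generic ⟩
  (v ∘ π₂) ∘ ⟨ ! , x ⟩       ≈⟨ ∘π₂-β ⟩
  v ∘ x                      ∎
  where
  generic : u ∘ π₂ ≈ v ∘ π₂
  generic = by-cases (≈-trans ∘π₂-β (≈-trans at-zero (≈-sym ∘π₂-β)))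
                     (≈-trans ∘π₂-β (≈-trans at-succ (≈-sym ∘π₂-β)))

sign-idem : ∀ {Γ} {x : Hom Γ ℕo} → sign ∘ (sign ∘ x) ≈ sign ∘ x
sign-idem = ≈-trans sym-assoc (unary-by-cases (sign ∘ sign) sign
  (≈-trans assoc (≈-trans (∘-congʳ sign-zero) (≈-trans sign-zero (≈-sym sign-zero))))
  (≈-trans assoc (≈-trans (∘-congʳ sign-succ) (≈-trans sign-true (≈-sym sign-succ)))))

and-zeroˡ : ∀ {Γ} {y : Hom Γ ℕo} → and ∘ ⟨ false , y ⟩ ≈ false
and-zeroˡ = ≈-trans assoc (≈-trans (∘-congʳ mul-zeroˡ) sign-zero)

and-zeroʳ : ∀ {Γ} {y : Hom Γ ℕo} → and ∘ ⟨ y , false ⟩ ≈ false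
and-zeroʳ = ≈-trans assoc (≈-trans (∘-congʳ mul-zeroʳ) sign-zero)

and-succ-succ : ∀ {Γ} {x y : Hom Γ ℕo} → and ∘ ⟨ succ ∘ x , succ ∘ y ⟩ ≈ true
and-succ-succ = ≈-trans assoc (≈-trans (∘-congʳ (≈-trans mul-succʳ add-succʳ)) sign-succ)

or-zero-zero : ∀ {Γ} → or ∘ ⟨ false {Γ} , false ⟩ ≈ false
or-zero-zero = ≈-trans assoc (≈-trans (∘-congʳ add-zeroʳ) sign-zero)

or-succˡ : ∀ {Γ} {x y : Hom Γ ℕo} → or ∘ ⟨ succ ∘ x , y ⟩ ≈ true
or-succˡ = ≈-trans assoc (≈-trans (∘-congʳ add-succˡ) sign-succ)

or-succʳ : ∀ {Γ} {x y : Hom Γ ℕo} → or ∘ ⟨ x , succ ∘ y ⟩ ≈ true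
or-succʳ = ≈-trans assoc (≈-trans (∘-congʳ add-succʳ) sign-succ)

imp-unfold : ∀ {Γ} {p q : Hom Γ ℕo} → imp ∘ ⟨ p , q ⟩ ≈ or ∘ ⟨ neg ∘ p , q ⟩
imp-unfold = ≈-trans app-∘ (arg-cong ∘π₁-β π₂-β)

imp-false : ∀ {Γ} {q : Hom Γ ℕo} → imp ∘ ⟨ false , q ⟩ ≈ true
imp-false = ≈-trans imp-unfold (≈-trans (argˡ-cong (≈-trans neg-zero true≈succ-false)) or-succˡ)

imp-true : ∀ {Γ} {q : Hom Γ ℕo} → imp ∘ ⟨ true , q ⟩ ≈ sign ∘ q
imp-true = ≈-trans imp-unfold (≈-trans (argˡ-cong neg-true) (≈-trans assoc (∘-congʳ add-zeroˡ)))

add-oneʳ : ∀ {Γ} {x : Hom Γ ℕo} → add ∘ ⟨ x , true ⟩ ≈ succ ∘ x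
add-oneʳ = ≈-trans (argʳ-cong true≈succ-false) (≈-trans add-succʳ (∘-congʳ add-zeroʳ))

monus-oneʳ : ∀ {Γ} {x : Hom Γ ℕo} → monus ∘ ⟨ succ ∘ x , true ⟩ ≈ x
monus-oneʳ = ≈-trans (argʳ-cong true≈succ-false) (≈-trans monus-succ-succ monus-zeroʳ)

-- Truth values.  A map is boolean when sign fixes it, i.e. it only takes
-- the values 0 and 1.

Boolean : ∀ {Γ} → Hom Γ ℕo → Set
Boolean t = sign ∘ t ≈ t

boolean-∘ : ∀ {Γ Δ} {x : Hom Γ ℕo} {σ : Hom Δ Γ} → Boolean x → Boolean (x ∘ σ)
boolean-∘ b = ≈-trans sym-assoc (∘-congˡ b)

boolean-and : ∀ {Γ} {x y : Hom Γ ℕo} → Boolean (and ∘ ⟨ x , y ⟩)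
boolean-and = ≈-trans (∘-congʳ assoc) (≈-trans sign-idem (≈-sym assoc))

boolean-imp : ∀ {Γ} {x y : Hom Γ ℕo} → Boolean (imp ∘ ⟨ x , y ⟩)
boolean-imp = ≈-trans (∘-congʳ (≈-trans imp-unfold assoc))
  (≈-trans sign-idem (≈-sym (≈-trans imp-unfold assoc)))

-- Propositional logic over boolean maps: a formula that is a tautology
-- (checked by truth tables) denotes true under every boolean environment.
module Propositional where

  infixr 4 _⇒_
  infixr 6 _∧_

  data Formula (n : ℕ) : Set where
    var   : Fin n → Formula n
    ⊤ ⊥   : Formula n
    _∧_ _⇒_ : Formula n → Formula n → Formula n

  Env : Obj → ℕ → Set
  Env Γ n = Fin n → Hom Γ ℕo

  ⟦_⟧ : ∀ {n Γ} → Formula n → Env Γ n → Hom Γ ℕo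
  ⟦ var i ⟧ ρ = ρ i
  ⟦ ⊤ ⟧ ρ     = true
  ⟦ ⊥ ⟧ ρ     = false
  ⟦ e ∧ f ⟧ ρ = and ∘ ⟨ ⟦ e ⟧ ρ , ⟦ f ⟧ ρ ⟩
  ⟦ e ⇒ f ⟧ ρ = imp ∘ ⟨ ⟦ e ⟧ ρ , ⟦ f ⟧ ρ ⟩

  ⟦⟧-cong : ∀ {n Γ} (e : Formula n) {ρ ρ' : Env Γ n} → (∀ i → ρ i ≈ ρ' i) → ⟦ e ⟧ ρ ≈ ⟦ e ⟧ ρ'
  ⟦⟧-cong (var i) p = p i
  ⟦⟧-cong ⊤ p       = ≈-refl
  ⟦⟧-cong ⊥ p       = ≈-refl
  ⟦⟧-cong (e ∧ f) p = arg-cong (⟦⟧-cong e p) (⟦⟧-cong f p)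
  ⟦⟧-cong (e ⇒ f) p = arg-cong (⟦⟧-cong e p) (⟦⟧-cong f p)

  ⟦⟧-∘ : ∀ {n Γ Δ} (e : Formula n) (ρ : Env Γ n) (σ : Hom Δ Γ) → ⟦ e ⟧ ρ ∘ σ ≈ ⟦ e ⟧ (λ i → ρ i ∘ σ)
  ⟦⟧-∘ (var i) ρ σ = ≈-refl
  ⟦⟧-∘ ⊤ ρ σ       = const-∘
  ⟦⟧-∘ ⊥ ρ σ       = const-∘
  ⟦⟧-∘ (e ∧ f) ρ σ = ≈-trans app-∘ (arg-cong (⟦⟧-∘ e ρ σ) (⟦⟧-∘ f ρ σ))
  ⟦⟧-∘ (e ⇒ f) ρ σ = ≈-trans app-∘ (arg-cong (⟦⟧-∘ e ρ σ) (⟦⟧-∘ f ρ σ))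

  const : ∀ {n} → Bool → Formula n
  const tt = ⊤
  const ff = ⊥

  value : ∀ {Γ} → Bool → Hom Γ ℕo
  value tt = true
  value ff = false

  instantiate : ∀ {n} → Formula (nsuc n) → Bool → Formula n
  instantiate (var fz) b     = const b
  instantiate (var (fs i)) b = var i
  instantiate ⊤ b            = ⊤
  instantiate ⊥ b            = ⊥
  instantiate (e ∧ f) b      = instantiate e b ∧ instantiate f b
  instantiate (e ⇒ f) b      = instantiate e b ⇒ instantiate f b

  _▸_ : ∀ {Γ n} → Hom Γ ℕo → Env Γ n → Env Γ (nsuc n)
  (t ▸ ρ) fz     = t
  (t ▸ ρ) (fs i) = ρ i

  ⟦instantiate⟧ : ∀ {n Γ} (e : Formula (nsuc n)) (b : Bool) (ρ : Env Γ n) →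
                  ⟦ e ⟧ (value b ▸ ρ) ≈ ⟦ instantiate e b ⟧ ρ
  ⟦instantiate⟧ (var fz) tt ρ   = ≈-refl
  ⟦instantiate⟧ (var fz) ff ρ   = ≈-refl
  ⟦instantiate⟧ (var (fs i)) b ρ = ≈-refl
  ⟦instantiate⟧ ⊤ b ρ           = ≈-refl
  ⟦instantiate⟧ ⊥ b ρ           = ≈-refl
  ⟦instantiate⟧ (e ∧ f) b ρ     = arg-cong (⟦instantiate⟧ e b ρ) (⟦instantiate⟧ f b ρ)
  ⟦instantiate⟧ (e ⇒ f) b ρ     = arg-cong (⟦instantiate⟧ e b ρ) (⟦instantiate⟧ f b ρ)

  and-table : ∀ {Γ} (a b : Bool) → and ∘ ⟨ value {Γ} a , value b ⟩ ≈ value (a && b)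
  and-table tt tt = ≈-trans (arg-cong true≈succ-false true≈succ-false) and-succ-succ
  and-table tt ff = and-zeroʳ
  and-table ff b  = and-zeroˡ

  imp-table : ∀ {Γ} (a b : Bool) → imp ∘ ⟨ value {Γ} a , value b ⟩ ≈ value (if a then b else tt)
  imp-table tt tt = ≈-trans imp-true sign-true
  imp-table tt ff = ≈-trans imp-true sign-zero
  imp-table ff b  = imp-false

  evaluate : Formula 0 → Bool
  evaluate (var ())
  evaluate ⊤       = tt
  evaluate ⊥       = ff
  evaluate (e ∧ f) = evaluate e && evaluate f
  evaluate (e ⇒ f) = if evaluate e then evaluate f else tt

  ⟦⟧-closed : ∀ {Γ} (e : Formula 0) (ρ : Env Γ 0) → ⟦ e ⟧ ρ ≈ value (evaluate e)
  ⟦⟧-closed (var ()) ρ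
  ⟦⟧-closed ⊤ ρ       = ≈-refl
  ⟦⟧-closed ⊥ ρ       = ≈-refl
  ⟦⟧-closed (e ∧ f) ρ = ≈-trans (arg-cong (⟦⟧-closed e ρ) (⟦⟧-closed f ρ)) (and-table (evaluate e) (evaluate f))
  ⟦⟧-closed (e ⇒ f) ρ = ≈-trans (arg-cong (⟦⟧-closed e ρ) (⟦⟧-closed f ρ)) (imp-table (evaluate e) (evaluate f))

  tautology : ∀ {n} → Formula n → Bool
  tautology {nzero}  e = evaluate e
  tautology {nsuc n} e = tautology (instantiate e ff) && tautology (instantiate e tt)

  BooleanEnv : ∀ {Γ n} → Env Γ n → Set
  BooleanEnv ρ = ∀ i → Boolean (ρ i)

  -- Variable 0 is made generic as  sign ∘ π₂  on Γ × ℕ; case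
  -- analysis on that ℕ component covers its two values 0 and 1.
  tautology-sound : ∀ {n Γ} (e : Formula n) → T (tautology e) → (ρ : Env Γ n) → BooleanEnv ρ →
                    ⟦ e ⟧ ρ ≈ true
  tautology-sound {nzero} e t ρ _ = ≈-trans (⟦⟧-closed e ρ) (is-true (evaluate e) t)
    where
    is-true : ∀ b → T b → value b ≈ true
    is-true tt _ = ≈-refl
  tautology-sound {nsuc n} {Γ} e t ρ bρ = begin
    ⟦ e ⟧ ρ                                 ≈⟨ ⟦⟧-cong e at-ρ₀ ⟩
    ⟦ e ⟧ (λ i → generic i ∘ ⟨ id , ρ fz ⟩) ≈⟨ ⟦⟧-∘ e generic ⟨ id , ρ fz ⟩ ⟨
    H ∘ ⟨ id , ρ fz ⟩                       ≈⟨ ∘-congˡ H-true ⟩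
    true ∘ ⟨ id , ρ fz ⟩                    ≈⟨ const-∘ ⟩
    true                                    ∎
    where
    rest : Env Γ n
    rest i = ρ (fs i)
    generic : Env (Γ ⊗ ℕo) (nsuc n)
    generic = (sign ∘ π₂) ▸ (λ i → rest i ∘ π₁)
    H : Hom (Γ ⊗ ℕo) ℕo
    H = ⟦ e ⟧ generic
    at-ρ₀ : ∀ i → ρ i ≈ generic i ∘ ⟨ id , ρ fz ⟩
    at-ρ₀ fz     = ≈-sym (≈-trans ∘π₂-β (bρ fz))
    at-ρ₀ (fs i) = ≈-sym (≈-trans ∘π₁-β idʳ)
    at-false : ∀ i → generic i ∘ σ₀ ≈ (false ▸ rest) i
    at-false fz     = ≈-trans ∘π₂-β sign-zero
    at-false (fs i) = ≈-trans ∘π₁-β idʳ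
    at-true : ∀ i → generic i ∘ σₛ ≈ (true ▸ (λ j → rest j ∘ π₁)) i
    at-true fz     = ≈-trans ∘π₂-β sign-succ
    at-true (fs i) = ∘π₁-β
    H-true : H ≈ true
    H-true = by-cases
      (begin
        H ∘ σ₀                                ≈⟨ ≈-trans (⟦⟧-∘ e generic σ₀) (⟦⟧-cong e at-false) ⟩
        ⟦ e ⟧ (false ▸ rest)                  ≈⟨ ⟦instantiate⟧ e ff rest ⟩
        ⟦ instantiate e ff ⟧ rest             ≈⟨ tautology-sound (instantiate e ff) (T-∧ˡ t) rest (λ i → bρ (fs i)) ⟩
        true                                  ≈⟨ const-∘ ⟨
        true ∘ σ₀                             ∎)
      (begin
        H ∘ σₛ                                ≈⟨ ≈-trans (⟦⟧-∘ e generic σₛ) (⟦⟧-cong e at-true) ⟩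
        ⟦ e ⟧ (true ▸ (λ j → rest j ∘ π₁))    ≈⟨ ⟦instantiate⟧ e tt _ ⟩
        ⟦ instantiate e tt ⟧ (λ j → rest j ∘ π₁)
                                              ≈⟨ tautology-sound (instantiate e tt) (T-∧ʳ {tautology (instantiate e ff)} t)
                                                   _ (λ i → boolean-∘ (bρ (fs i))) ⟩
        true                                  ≈⟨ const-∘ ⟨
        true ∘ σₛ                             ∎)
      where
      T-∧ˡ : ∀ {a b} → T (a && b) → T a
      T-∧ˡ {tt} {tt} _ = _
      T-∧ʳ : ∀ {a b} → T (a && b) → T b
      T-∧ʳ {tt} {tt} _ = _

  ⟦⟧-boolean : ∀ {n Γ} (e : Formula n) (ρ : Env Γ n) → BooleanEnv ρ → Boolean (⟦ e ⟧ ρ)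
  ⟦⟧-boolean (var i) ρ b = b i
  ⟦⟧-boolean ⊤ ρ b       = sign-true
  ⟦⟧-boolean ⊥ ρ b       = sign-zero
  ⟦⟧-boolean (e ∧ f) ρ b = boolean-and
  ⟦⟧-boolean (e ⇒ f) ρ b = boolean-imp

  tautology-mp : ∀ {n Γ} (h c : Formula n) → T (tautology (h ⇒ c)) → (ρ : Env Γ n) → BooleanEnv ρ →
                 ⟦ h ⟧ ρ ≈ true → ⟦ c ⟧ ρ ≈ true
  tautology-mp h c t ρ b p = begin
    ⟦ c ⟧ ρ                          ≈⟨ ⟦⟧-boolean c ρ b ⟨
    sign ∘ ⟦ c ⟧ ρ                   ≈⟨ imp-true ⟨
    imp ∘ ⟨ true , ⟦ c ⟧ ρ ⟩          ≈⟨ argˡ-cong p ⟨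
    imp ∘ ⟨ ⟦ h ⟧ ρ , ⟦ c ⟧ ρ ⟩       ≈⟨ tautology-sound (h ⇒ c) t ρ b ⟩
    true                             ∎

infix 4 _⊑_
_⊑_ : ∀ {Γ} → Hom Γ ℕo → Hom Γ ℕo → Set
p ⊑ q = imp ∘ ⟨ p , q ⟩ ≈ true

⊑-congʳ : ∀ {Γ} {p q q' : Hom Γ ℕo} → q ≈ q' → p ⊑ q → p ⊑ q'
⊑-congʳ q≈q' h = ≈-trans (argʳ-cong (≈-sym q≈q')) h

⊑-∘ : ∀ {Γ Δ} {p q : Hom Γ ℕo} (σ : Hom Δ Γ) → p ⊑ q → p ∘ σ ⊑ q ∘ σ
⊑-∘ σ h = ≈-trans (≈-sym app-∘) (≈-trans (∘-congˡ h) const-∘)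

⊑-true : ∀ {Γ} {p : Hom Γ ℕo} → p ⊑ true
⊑-true = ≈-trans imp-unfold (≈-trans (argʳ-cong true≈succ-false) or-succʳ)

module _ where
  open Propositional

  private
    x₀ x₁ x₂ : Formula 3
    x₀ = var fz
    x₁ = var (fs fz)
    x₂ = var (fs (fs fz))

    env : ∀ {Γ} → Hom Γ ℕo → Hom Γ ℕo → Hom Γ ℕo → Env Γ 3
    env p q r fz           = p
    env p q r (fs fz)      = q
    env p q r (fs (fs fz)) = r

    boolean-env : ∀ {Γ} {p q r : Hom Γ ℕo} → Boolean p → Boolean q → Boolean r → BooleanEnv (env p q r)
    boolean-env bp bq br fz           = bp
    boolean-env bp bq br (fs fz)      = bq
    boolean-env bp bq br (fs (fs fz)) = br

    both : ∀ {Γ} {x y : Hom Γ ℕo} → x ≈ true → y ≈ true → and ∘ ⟨ x , y ⟩ ≈ true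
    both p q = ≈-trans (arg-cong p q) (and-table tt tt)

  ⊑-refl : ∀ {Γ} {p : Hom Γ ℕo} → Boolean p → p ⊑ p
  ⊑-refl bp = tautology-sound (x₀ ⇒ x₀) _ (env _ true true) (boolean-env bp sign-true sign-true)

  ⊑-trans : ∀ {Γ} {p q r : Hom Γ ℕo} → Boolean p → Boolean q → Boolean r → p ⊑ q → q ⊑ r → p ⊑ r
  ⊑-trans bp bq br h₁ h₂ =
    tautology-mp ((x₀ ⇒ x₁) ∧ (x₁ ⇒ x₂)) (x₀ ⇒ x₂) _ (env _ _ _) (boolean-env bp bq br) (both h₁ h₂)

  ⊑-∧-intro : ∀ {Γ} {p q r : Hom Γ ℕo} → Boolean p → Boolean q → Boolean r →
              p ⊑ q → p ⊑ r → p ⊑ and ∘ ⟨ q , r ⟩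
  ⊑-∧-intro bp bq br h₁ h₂ =
    tautology-mp ((x₀ ⇒ x₁) ∧ (x₀ ⇒ x₂)) (x₀ ⇒ (x₁ ∧ x₂)) _ (env _ _ _) (boolean-env bp bq br) (both h₁ h₂)

  ⊑-∧-elimˡ : ∀ {Γ} {p q : Hom Γ ℕo} → Boolean p → Boolean q → and ∘ ⟨ p , q ⟩ ⊑ p
  ⊑-∧-elimˡ bp bq = tautology-sound ((x₀ ∧ x₁) ⇒ x₀) _ (env _ _ true) (boolean-env bp bq sign-true)

  ⊑-∧-elimʳ : ∀ {Γ} {p q : Hom Γ ℕo} → Boolean p → Boolean q → and ∘ ⟨ p , q ⟩ ⊑ q
  ⊑-∧-elimʳ bp bq = tautology-sound ((x₀ ∧ x₁) ⇒ x₁) _ (env _ _ true) (boolean-env bp bq sign-true)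

  ⊑-⇒-mono : ∀ {Γ} {e q q' : Hom Γ ℕo} → Boolean e → Boolean q → Boolean q' →
             q ⊑ q' → imp ∘ ⟨ e , q ⟩ ⊑ imp ∘ ⟨ e , q' ⟩
  ⊑-⇒-mono be bq bq' h =
    tautology-mp (x₁ ⇒ x₂) ((x₀ ⇒ x₁) ⇒ (x₀ ⇒ x₂)) _ (env _ _ _) (boolean-env be bq bq') h

  ⊑-uncurry : ∀ {Γ} {p q r : Hom Γ ℕo} → Boolean p → Boolean q → Boolean r →
              p ⊑ imp ∘ ⟨ q , r ⟩ → and ∘ ⟨ q , p ⟩ ⊑ r
  ⊑-uncurry bp bq br h =
    tautology-mp (x₀ ⇒ (x₁ ⇒ x₂)) ((x₁ ∧ x₀) ⇒ x₂) _ (env _ _ _) (boolean-env bp bq br) h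

update : ∀ {n} {A : Set} → (Fin n → A) → Fin n → A → Fin n → A
update f fz x fz          = x
update f fz x (fs j)      = f (fs j)
update f (fs i) x fz      = f fz
update f (fs i) x (fs j)  = update (λ k → f (fs k)) i x j

update-pointwise : ∀ {n} {A B : Set} (R : A → B → Set) {f : Fin n → A} {g : Fin n → B} (i : Fin n) {x : A} {y : B} →
                   (∀ j → R (f j) (g j)) → R x y → ∀ j → R (update f i x j) (update g i y j)
update-pointwise R fz fg xy fz          = xy
update-pointwise R fz fg xy (fs j)      = fg (fs j)
update-pointwise R (fs i) fg xy fz      = fg fz
update-pointwise R (fs i) fg xy (fs j)  = update-pointwise R i (λ k → fg (fs k)) xy j

update-self : ∀ {n} {A : Set} (f : Fin n → A) (i j : Fin n) → update f i (f i) j ≡ f j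
update-self f fz fz          = refl
update-self f fz (fs j)      = refl
update-self f (fs i) fz      = refl
update-self f (fs i) (fs j)  = update-self (λ k → f (fs k)) i j

update-at : ∀ {n} {A : Set} (f : Fin n → A) (i : Fin n) {x : A} → update f i x i ≡ x
update-at f fz     = refl
update-at f (fs i) = update-at (λ k → f (fs k)) i

update-update : ∀ {n} {A : Set} (f : Fin n → A) (i j : Fin n) {x y : A} →
                update (update f i x) i y j ≡ update f i y j
update-update f fz fz          = refl
update-update f fz (fs j)      = refl
update-update f (fs i) fz      = refl
update-update f (fs i) (fs j)  = update-update (λ k → f (fs k)) i j

≡⇒≈ : ∀ {A B} {f g : Hom A B} → f ≡ g → f ≈ g
≡⇒≈ refl = ≈-refl

-- Equations between terms can be proved by case
-- analysis on any variable: this is how identities in several variables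
-- are established below.
module Terms (Δ : Obj) where

  data Term (n : ℕ) : Set where
    var : Fin n → Term n
    con : Hom 𝟙 ℕo → Term n
    op₁ : Hom ℕo ℕo → Term n → Term n
    op₂ : Hom (ℕo ⊗ ℕo) ℕo → Term n → Term n → Term n
    app : Hom (Δ ⊗ (ℕo ⊗ ℕo)) ℕo → Term n → Term n → Term n

  Env : Obj → ℕ → Set
  Env Γ n = Fin n → Hom Γ ℕo

  ⟦_⟧ : ∀ {n Γ} → Term n → Hom Γ Δ → Env Γ n → Hom Γ ℕo
  ⟦ var i ⟧ δ ρ     = ρ i
  ⟦ con c ⟧ δ ρ     = c ∘ !
  ⟦ op₁ F t ⟧ δ ρ   = F ∘ ⟦ t ⟧ δ ρ
  ⟦ op₂ F t u ⟧ δ ρ = F ∘ ⟨ ⟦ t ⟧ δ ρ , ⟦ u ⟧ δ ρ ⟩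
  ⟦ app R t u ⟧ δ ρ = R ∘ ⟨ δ , ⟨ ⟦ t ⟧ δ ρ , ⟦ u ⟧ δ ρ ⟩ ⟩

  ⟦⟧-cong : ∀ {n Γ} (t : Term n) {δ δ' : Hom Γ Δ} {ρ ρ' : Env Γ n} →
            δ ≈ δ' → (∀ i → ρ i ≈ ρ' i) → ⟦ t ⟧ δ ρ ≈ ⟦ t ⟧ δ' ρ'
  ⟦⟧-cong (var i) d p     = p i
  ⟦⟧-cong (con c) d p     = ≈-refl
  ⟦⟧-cong (op₁ F t) d p   = ∘-congʳ (⟦⟧-cong t d p)
  ⟦⟧-cong (op₂ F t u) d p = arg-cong (⟦⟧-cong t d p) (⟦⟧-cong u d p)
  ⟦⟧-cong (app R t u) d p = arg-cong d (⟨⟩-cong (⟦⟧-cong t d p) (⟦⟧-cong u d p))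

  ⟦⟧-∘ : ∀ {n Γ Γ'} (t : Term n) (δ : Hom Γ Δ) (ρ : Env Γ n) (τ : Hom Γ' Γ) →
         ⟦ t ⟧ δ ρ ∘ τ ≈ ⟦ t ⟧ (δ ∘ τ) (λ i → ρ i ∘ τ)
  ⟦⟧-∘ (var i) δ ρ τ     = ≈-refl
  ⟦⟧-∘ (con c) δ ρ τ     = const-∘
  ⟦⟧-∘ (op₁ F t) δ ρ τ   = ≈-trans assoc (∘-congʳ (⟦⟧-∘ t δ ρ τ))
  ⟦⟧-∘ (op₂ F t u) δ ρ τ = ≈-trans app-∘ (arg-cong (⟦⟧-∘ t δ ρ τ) (⟦⟧-∘ u δ ρ τ))
  ⟦⟧-∘ (app R t u) δ ρ τ =
    ≈-trans app-∘ (argʳ-cong (≈-trans ⟨⟩∘ (⟨⟩-cong (⟦⟧-∘ t δ ρ τ) (⟦⟧-∘ u δ ρ τ))))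

  subst : ∀ {n m} → (Fin n → Term m) → Term n → Term m
  subst θ (var i)     = θ i
  subst θ (con c)     = con c
  subst θ (op₁ F t)   = op₁ F (subst θ t)
  subst θ (op₂ F t u) = op₂ F (subst θ t) (subst θ u)
  subst θ (app R t u) = app R (subst θ t) (subst θ u)

  ⟦subst⟧ : ∀ {n m Γ} (θ : Fin n → Term m) (t : Term n) (δ : Hom Γ Δ) (ρ : Env Γ m) →
            ⟦ subst θ t ⟧ δ ρ ≈ ⟦ t ⟧ δ (λ i → ⟦ θ i ⟧ δ ρ)
  ⟦subst⟧ θ (var i) δ ρ     = ≈-refl
  ⟦subst⟧ θ (con c) δ ρ     = ≈-refl
  ⟦subst⟧ θ (op₁ F t) δ ρ   = ∘-congʳ (⟦subst⟧ θ t δ ρ)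
  ⟦subst⟧ θ (op₂ F t u) δ ρ = arg-cong (⟦subst⟧ θ t δ ρ) (⟦subst⟧ θ u δ ρ)
  ⟦subst⟧ θ (app R t u) δ ρ = argʳ-cong (⟨⟩-cong (⟦subst⟧ θ t δ ρ) (⟦subst⟧ θ u δ ρ))

  _[_≔_] : ∀ {n} → Term n → Fin n → Term n → Term n
  t [ i ≔ u ] = subst (update var i u) t

  ⟦≔⟧ : ∀ {n Γ} (t : Term n) (i : Fin n) (u : Term n) (δ : Hom Γ Δ) (ρ : Env Γ n) →
        ⟦ t [ i ≔ u ] ⟧ δ ρ ≈ ⟦ t ⟧ δ (update ρ i (⟦ u ⟧ δ ρ))
  ⟦≔⟧ t i u δ ρ = ≈-trans (⟦subst⟧ (update var i u) t δ ρ)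
    (⟦⟧-cong t ≈-refl (update-pointwise (λ a b → ⟦ a ⟧ δ ρ ≈ b) i (λ _ → ≈-refl) ≈-refl))

  infix 3 _≋_
  _≋_ : ∀ {n} → Term n → Term n → Set
  _≋_ {n} t₁ t₂ = ∀ {Γ} (δ : Hom Γ Δ) (ρ : Env Γ n) → ⟦ t₁ ⟧ δ ρ ≈ ⟦ t₂ ⟧ δ ρ

  infixl 6 _+ᵗ_ _∸ᵗ_
  infixl 7 _·ᵗ_
  infixr 5 _∧ᵗ_
  infixr 4 _⇒ᵗ_

  zeroᵗ oneᵗ : ∀ {n} → Term n
  zeroᵗ = con zero
  oneᵗ  = con one

  sᵗ ¬ᵗ sgᵗ : ∀ {n} → Term n → Term n
  sᵗ  = op₁ succ
  ¬ᵗ  = op₁ neg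
  sgᵗ = op₁ sign

  _+ᵗ_ _∸ᵗ_ _·ᵗ_ _∧ᵗ_ _⇒ᵗ_ : ∀ {n} → Term n → Term n → Term n
  _+ᵗ_ = op₂ add
  _∸ᵗ_ = op₂ monus
  _·ᵗ_ = op₂ mul
  _∧ᵗ_ = op₂ and
  _⇒ᵗ_ = op₂ imp

  -- Case analysis on the variable i.  Making i generic (the ℕ component
  -- of Γ × ℕ) turns both sides into maps out of Γ × ℕ, to which by-cases
  -- applies.
  by-cases-on : ∀ {n} (i : Fin n) (t₁ t₂ : Term n) →
                t₁ [ i ≔ zeroᵗ ] ≋ t₂ [ i ≔ zeroᵗ ] → t₁ [ i ≔ sᵗ (var i) ] ≋ t₂ [ i ≔ sᵗ (var i) ] →
                t₁ ≋ t₂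
  by-cases-on {n} i t₁ t₂ h₀ hₛ {Γ} δ ρ = begin
    ⟦ t₁ ⟧ δ ρ                 ≈⟨ at-ρᵢ t₁ ⟨
    H t₁ ∘ ⟨ id , ρ i ⟩        ≈⟨ ∘-congˡ H₁≈H₂ ⟩
    H t₂ ∘ ⟨ id , ρ i ⟩        ≈⟨ at-ρᵢ t₂ ⟩
    ⟦ t₂ ⟧ δ ρ                 ∎
    where
    ρ₁ : Env (Γ ⊗ ℕo) n
    ρ₁ = update (λ j → ρ j ∘ π₁) i π₂
    H : Term n → Hom (Γ ⊗ ℕo) ℕo
    H t = ⟦ t ⟧ (δ ∘ π₁) ρ₁
    H-∘ : ∀ {Γ'} (t : Term n) (τ : Hom Γ' (Γ ⊗ ℕo)) →
          H t ∘ τ ≈ ⟦ t ⟧ (δ ∘ (π₁ ∘ τ)) (update (λ j → ρ j ∘ (π₁ ∘ τ)) i (π₂ ∘ τ))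
    H-∘ t τ = ≈-trans (⟦⟧-∘ t (δ ∘ π₁) ρ₁ τ) (⟦⟧-cong t assoc
      (update-pointwise (λ a b → a ∘ τ ≈ b) i (λ _ → assoc) ≈-refl))
    at-ρᵢ : ∀ t → H t ∘ ⟨ id , ρ i ⟩ ≈ ⟦ t ⟧ δ ρ
    at-ρᵢ t = ≈-trans (H-∘ t ⟨ id , ρ i ⟩) (⟦⟧-cong t (≈-trans (∘-congʳ π₁-β) idʳ)
      (λ j → ≈-trans (update-pointwise _≈_ i (λ _ → ≈-trans (∘-congʳ π₁-β) idʳ) π₂-β j)
                     (≡⇒≈ (update-self ρ i j))))
    at-zero : ∀ t → H t ∘ σ₀ ≈ ⟦ t [ i ≔ zeroᵗ ] ⟧ δ ρ
    at-zero t = ≈-trans (H-∘ t σ₀) (≈-trans (⟦⟧-cong t (≈-trans (∘-congʳ π₁-β) idʳ)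
      (update-pointwise _≈_ i (λ _ → ≈-trans (∘-congʳ π₁-β) idʳ) π₂-β))
      (≈-sym (⟦≔⟧ t i zeroᵗ δ ρ)))
    at-succ : ∀ t → H t ∘ σₛ ≈ ⟦ t [ i ≔ sᵗ (var i) ] ⟧ (δ ∘ π₁) ρ₁
    at-succ t = ≈-trans (H-∘ t σₛ) (≈-trans (⟦⟧-cong t (∘-congʳ π₁-β)
      (λ j → ≈-trans (update-pointwise _≈_ i (λ _ → ∘-congʳ π₁-β) π₂-β j)
        (≈-sym (≈-trans (≡⇒≈ (update-update (λ k → ρ k ∘ π₁) i j))
                        (update-pointwise _≈_ i (λ _ → ≈-refl)
                                          (∘-congʳ (≡⇒≈ (update-at (λ k → ρ k ∘ π₁) i))) j)))))
      (≈-sym (⟦≔⟧ t i (sᵗ (var i)) (δ ∘ π₁) ρ₁)))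
    H₁≈H₂ : H t₁ ≈ H t₂
    H₁≈H₂ = by-cases (≈-trans (at-zero t₁) (≈-trans (h₀ δ ρ) (≈-sym (at-zero t₂))))
                     (≈-trans (at-succ t₁) (≈-trans (hₛ (δ ∘ π₁) ρ₁) (≈-sym (at-succ t₂))))

-- For all a, b there is c (namely min(a, b)) with
--   (a ∸ b) + c = a   and   (b ∸ a) + c = b.
-- It is computed by a machine on states (p, q, c) which, while p and q are
-- both positive, moves one unit from each of p and q into c.  Run for a
-- steps from (a, b, 0), the sums p + c, q + c and the differences p ∸ q,
-- q ∸ p are invariant, and at the end p or q is exhausted, so that
-- p = a ∸ b and q = b ∸ a.
module CommonPart where
  open Terms 𝟙

  module StepIdentities where
    p q c n : Term 4
    p = var fz
    q = var (fs fz)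
    c = var (fs (fs fz))
    n = var (fs (fs (fs fz)))

    -- g = [p ∧ q]: the amount moved by one step.
    g : Term 4
    g = p ∧ᵗ q

    by-cases-p-q : (t₁ t₂ : Term 4) →
      t₁ [ fz ≔ zeroᵗ ] ≋ t₂ [ fz ≔ zeroᵗ ] →
      t₁ [ fz ≔ sᵗ p ] [ fs fz ≔ zeroᵗ ] ≋ t₂ [ fz ≔ sᵗ p ] [ fs fz ≔ zeroᵗ ] →
      t₁ [ fz ≔ sᵗ p ] [ fs fz ≔ sᵗ q ] ≋ t₂ [ fz ≔ sᵗ p ] [ fs fz ≔ sᵗ q ] →
      t₁ ≋ t₂
    by-cases-p-q t₁ t₂ h₀ hₛ₀ hₛₛ =
      by-cases-on fz t₁ t₂ h₀ (by-cases-on (fs fz) (t₁ [ fz ≔ sᵗ p ]) (t₂ [ fz ≔ sᵗ p ]) hₛ₀ hₛₛ)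

    monus-by : ∀ {Γ} {x y : Hom Γ ℕo} → y ≈ false → monus ∘ ⟨ x , y ⟩ ≈ x
    monus-by h = ≈-trans (argʳ-cong h) monus-zeroʳ

    add-by : ∀ {Γ} {x y : Hom Γ ℕo} → y ≈ false → add ∘ ⟨ x , y ⟩ ≈ x
    add-by h = ≈-trans (argʳ-cong h) add-zeroʳ

    keeps-p+c : (p ∸ᵗ g) +ᵗ (c +ᵗ g) ≋ p +ᵗ c
    keeps-p+c = by-cases-p-q ((p ∸ᵗ g) +ᵗ (c +ᵗ g)) (p +ᵗ c)
      (λ δ ρ → arg-cong (monus-by and-zeroˡ) (add-by and-zeroˡ))
      (λ δ ρ → arg-cong (monus-by and-zeroʳ) (add-by and-zeroʳ))
      (λ δ ρ → ≈-trans (arg-cong (≈-trans (argʳ-cong and-succ-succ) monus-oneʳ)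
                                          (≈-trans (argʳ-cong and-succ-succ) add-oneʳ))
                       (≈-trans add-succʳ (≈-sym add-succˡ)))

    keeps-q+c : (q ∸ᵗ g) +ᵗ (c +ᵗ g) ≋ q +ᵗ c
    keeps-q+c = by-cases-p-q ((q ∸ᵗ g) +ᵗ (c +ᵗ g)) (q +ᵗ c)
      (λ δ ρ → arg-cong (monus-by and-zeroˡ) (add-by and-zeroˡ))
      (λ δ ρ → arg-cong (monus-by and-zeroʳ) (add-by and-zeroʳ))
      (λ δ ρ → ≈-trans (arg-cong (≈-trans (argʳ-cong and-succ-succ) monus-oneʳ)
                                          (≈-trans (argʳ-cong and-succ-succ) add-oneʳ))
                       (≈-trans add-succʳ (≈-sym add-succˡ)))

    keeps-p∸q : (p ∸ᵗ g) ∸ᵗ (q ∸ᵗ g) ≋ p ∸ᵗ q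
    keeps-p∸q = by-cases-p-q ((p ∸ᵗ g) ∸ᵗ (q ∸ᵗ g)) (p ∸ᵗ q)
      (λ δ ρ → arg-cong (monus-by and-zeroˡ) (monus-by and-zeroˡ))
      (λ δ ρ → arg-cong (monus-by and-zeroʳ) (monus-by and-zeroʳ))
      (λ δ ρ → ≈-trans (arg-cong (≈-trans (argʳ-cong and-succ-succ) monus-oneʳ)
                                          (≈-trans (argʳ-cong and-succ-succ) monus-oneʳ))
                       (≈-sym monus-succ-succ))

    keeps-q∸p : (q ∸ᵗ g) ∸ᵗ (p ∸ᵗ g) ≋ q ∸ᵗ p
    keeps-q∸p = by-cases-p-q ((q ∸ᵗ g) ∸ᵗ (p ∸ᵗ g)) (q ∸ᵗ p)
      (λ δ ρ → arg-cong (monus-by and-zeroˡ) (monus-by and-zeroˡ))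
      (λ δ ρ → arg-cong (monus-by and-zeroʳ) (monus-by and-zeroʳ))
      (λ δ ρ → ≈-trans (arg-cong (≈-trans (argʳ-cong and-succ-succ) monus-oneʳ)
                                          (≈-trans (argʳ-cong and-succ-succ) monus-oneʳ))
                       (≈-sym monus-succ-succ))

    g' : Term 4
    g' = (p ∸ᵗ g) ∧ᵗ (q ∸ᵗ g)

    both-vanish : ∀ {Γ} {x y z : Hom Γ ℕo} → x ≈ false → mul ∘ ⟨ x , y ⟩ ≈ mul ∘ ⟨ x , z ⟩
    both-vanish h = ≈-trans (argˡ-cong h) (≈-trans mul-zeroˡ (≈-sym (≈-trans (argˡ-cong h) mul-zeroˡ)))

    residue-step : g' ·ᵗ (sᵗ n ∸ᵗ (c +ᵗ g)) ≋ g' ·ᵗ (g ·ᵗ (n ∸ᵗ c))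
    residue-step = by-cases-p-q (g' ·ᵗ (sᵗ n ∸ᵗ (c +ᵗ g))) (g' ·ᵗ (g ·ᵗ (n ∸ᵗ c)))
      (λ δ ρ → both-vanish (≈-trans (argˡ-cong monus-zeroˡ) and-zeroˡ))
      (λ δ ρ → both-vanish (≈-trans (argʳ-cong monus-zeroˡ) and-zeroʳ))
      (λ δ ρ → argʳ-cong (≈-trans (argʳ-cong (≈-trans (argʳ-cong and-succ-succ) add-oneʳ))
               (≈-trans monus-succ-succ (≈-sym (≈-trans (argˡ-cong and-succ-succ) mul-oneˡ)))))

    sign-g·p-positive : ∀ {Γ} {x y : Hom Γ ℕo} →
                        sign ∘ (mul ∘ ⟨ and ∘ ⟨ succ ∘ x , succ ∘ y ⟩ , succ ∘ x ⟩) ≈ true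
    sign-g·p-positive = ≈-trans (∘-congʳ (≈-trans (argˡ-cong and-succ-succ) mul-oneˡ)) sign-succ

    -- If g · p = 0 then p or q is 0, hence p ∸ q = p and q ∸ p = q.
    exhausted-p : p ∸ᵗ (q ·ᵗ sgᵗ (g ·ᵗ p)) ≋ p ∸ᵗ q
    exhausted-p = by-cases-p-q (p ∸ᵗ (q ·ᵗ sgᵗ (g ·ᵗ p))) (p ∸ᵗ q)
      (λ δ ρ → ≈-trans monus-zeroˡ (≈-sym monus-zeroˡ))
      (λ δ ρ → argʳ-cong mul-zeroˡ)
      (λ δ ρ → argʳ-cong (≈-trans (argʳ-cong sign-g·p-positive) mul-oneʳ))

    exhausted-q : q ∸ᵗ (p ·ᵗ sgᵗ (g ·ᵗ p)) ≋ q ∸ᵗ p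
    exhausted-q = by-cases-p-q (q ∸ᵗ (p ·ᵗ sgᵗ (g ·ᵗ p))) (q ∸ᵗ p)
      (λ δ ρ → argʳ-cong mul-zeroˡ)
      (λ δ ρ → ≈-trans monus-zeroˡ (≈-sym monus-zeroˡ))
      (λ δ ρ → argʳ-cong (≈-trans (argʳ-cong sign-g·p-positive) mul-oneʳ))

    env : ∀ {Γ} → Hom Γ ℕo → Hom Γ ℕo → Hom Γ ℕo → Hom Γ ℕo → Env Γ 4
    env p q c n fz                = p
    env p q c n (fs fz)           = q
    env p q c n (fs (fs fz))      = c
    env p q c n (fs (fs (fs fz))) = n

  open StepIdentities using (keeps-p+c ; keeps-q+c ; keeps-p∸q ; keeps-q∸p ; residue-step ;
                             exhausted-p ; exhausted-q ; env)

  State : Obj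
  State = (ℕo ⊗ ℕo) ⊗ ℕo

  private
    P Q C G : Hom State ℕo
    P = π₁ ∘ π₁
    Q = π₂ ∘ π₁
    C = π₂
    G = and ∘ ⟨ P , Q ⟩

    step : Hom State State
    step = ⟨ ⟨ monus ∘ ⟨ P , G ⟩ , monus ∘ ⟨ Q , G ⟩ ⟩ , add ∘ ⟨ C , G ⟩ ⟩

    P-step : P ∘ step ≈ monus ∘ ⟨ P , G ⟩
    P-step = ≈-trans assoc (≈-trans (∘-congʳ π₁-β) π₁-β)

    Q-step : Q ∘ step ≈ monus ∘ ⟨ Q , G ⟩
    Q-step = ≈-trans assoc (≈-trans (∘-congʳ π₁-β) π₂-β)

    C-step : C ∘ step ≈ add ∘ ⟨ C , G ⟩
    C-step = π₂-β

    P-at : ∀ {Γ} {x y z : Hom Γ ℕo} → P ∘ ⟨ ⟨ x , y ⟩ , z ⟩ ≈ x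
    P-at = ≈-trans assoc (≈-trans (∘-congʳ π₁-β) π₁-β)

    Q-at : ∀ {Γ} {x y z : Hom Γ ℕo} → Q ∘ ⟨ ⟨ x , y ⟩ , z ⟩ ≈ y
    Q-at = ≈-trans assoc (≈-trans (∘-congʳ π₁-β) π₂-β)

    invariant-p+c : (add ∘ ⟨ P , C ⟩) ∘ step ≈ add ∘ ⟨ P , C ⟩
    invariant-p+c = ≈-trans app-∘ (≈-trans (arg-cong P-step C-step) (keeps-p+c ! (env P Q C false)))

    invariant-q+c : (add ∘ ⟨ Q , C ⟩) ∘ step ≈ add ∘ ⟨ Q , C ⟩
    invariant-q+c = ≈-trans app-∘ (≈-trans (arg-cong Q-step C-step) (keeps-q+c ! (env P Q C false)))

    invariant-p∸q : (monus ∘ ⟨ P , Q ⟩) ∘ step ≈ monus ∘ ⟨ P , Q ⟩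
    invariant-p∸q = ≈-trans app-∘ (≈-trans (arg-cong P-step Q-step) (keeps-p∸q ! (env P Q C false)))

    invariant-q∸p : (monus ∘ ⟨ Q , P ⟩) ∘ step ≈ monus ∘ ⟨ Q , P ⟩
    invariant-q∸p = ≈-trans app-∘ (≈-trans (arg-cong Q-step P-step) (keeps-q∸p ! (env P Q C false)))

    run : Hom ((ℕo ⊗ ℕo) ⊗ ℕo) State
    run = iter step ∘ (σ₀ ×₁ id)

    run-succ : run ∘ σₛ ≈ step ∘ run
    run-succ = ≈-trans assoc (≈-trans (∘-congʳ ×₁id-σₛ)
                 (≈-trans sym-assoc (≈-trans (∘-congˡ iter-succ) assoc)))

    run-invariant : ∀ {B} {I : Hom State B} → I ∘ step ≈ I → I ∘ run ≈ (I ∘ σ₀) ∘ π₁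
    run-invariant h = ≈-trans sym-assoc (≈-trans (∘-congˡ (iter-invariant h))
                        (≈-trans assoc (≈-trans (∘-congʳ π₁-β) sym-assoc)))

    module At {Γ : Obj} (s : Hom Γ State) where
      p q c g : Hom Γ ℕo
      p = P ∘ s
      q = Q ∘ s
      c = C ∘ s
      g = and ∘ ⟨ p , q ⟩

      g-at : G ∘ s ≈ g
      g-at = app-∘

      c-after-step : C ∘ (step ∘ s) ≈ add ∘ ⟨ c , g ⟩
      c-after-step = ≈-trans sym-assoc (≈-trans (∘-congˡ C-step) (≈-trans app-∘ (argʳ-cong g-at)))

      g-next : Hom Γ ℕo
      g-next = and ∘ ⟨ monus ∘ ⟨ p , g ⟩ , monus ∘ ⟨ q , g ⟩ ⟩

      g-after-step : G ∘ (step ∘ s) ≈ g-next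
      g-after-step = ≈-trans app-∘ (∘-congʳ (⟨⟩-cong
        (≈-trans sym-assoc (≈-trans (∘-congˡ P-step) (≈-trans app-∘ (argʳ-cong g-at))))
        (≈-trans sym-assoc (≈-trans (∘-congˡ Q-step) (≈-trans app-∘ (argʳ-cong g-at))))))

    -- The residue  g · (n ∸ c)  after n steps vanishes: each step multiplies
    -- it by the next g (residue-step), and it starts as g · (0 ∸ 0) = 0.
    residue : Hom ((ℕo ⊗ ℕo) ⊗ ℕo) ℕo
    residue = mul ∘ ⟨ G ∘ run , monus ∘ ⟨ π₂ , C ∘ run ⟩ ⟩

    residue≈0 : residue ≈ false
    residue≈0 = begin
      residue               ≈⟨ π₂-β ⟨
      π₂ ∘ ⟨ run , residue ⟩ ≈⟨ ∘-congʳ (iter-unique with-residue with-zero at-start) ⟩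
      π₂ ∘ ⟨ run , false ⟩  ≈⟨ π₂-β ⟩
      false                 ∎
      where
      open At run
      joint : Hom (State ⊗ ℕo) (State ⊗ ℕo)
      joint = ⟨ step ∘ π₁ , mul ∘ ⟨ G ∘ (step ∘ π₁) , π₂ ⟩ ⟩
      joint∘ : ∀ {Γ} {s : Hom Γ State} {y : Hom Γ ℕo} →
           joint ∘ ⟨ s , y ⟩ ≈ ⟨ step ∘ s , mul ∘ ⟨ G ∘ (step ∘ s) , y ⟩ ⟩
      joint∘ = ≈-trans ⟨⟩∘ (⟨⟩-cong ∘π₁-β
                 (≈-trans app-∘ (arg-cong (≈-trans assoc (∘-congʳ ∘π₁-β)) π₂-β)))
      residue-succ : residue ∘ σₛ ≈ mul ∘ ⟨ G ∘ (step ∘ run) , residue ⟩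
      residue-succ = begin
        residue ∘ σₛ
          ≈⟨ ≈-trans app-∘ (arg-cong (≈-trans assoc (∘-congʳ run-succ))
                                     (≈-trans app-∘ (arg-cong π₂-β (≈-trans assoc (∘-congʳ run-succ))))) ⟩
        mul ∘ ⟨ G ∘ (step ∘ run) , monus ∘ ⟨ succ ∘ π₂ , C ∘ (step ∘ run) ⟩ ⟩
          ≈⟨ arg-cong g-after-step (argʳ-cong c-after-step) ⟩
        mul ∘ ⟨ g-next , monus ∘ ⟨ succ ∘ π₂ , add ∘ ⟨ c , g ⟩ ⟩ ⟩
          ≈⟨ residue-step ! (env p q c π₂) ⟩
        mul ∘ ⟨ g-next , mul ∘ ⟨ g , monus ∘ ⟨ π₂ , c ⟩ ⟩ ⟩
          ≈⟨ arg-cong g-after-step (argˡ-cong g-at) ⟨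
        mul ∘ ⟨ G ∘ (step ∘ run) , residue ⟩ ∎
      with-residue : ⟨ run , residue ⟩ ∘ σₛ ≈ joint ∘ ⟨ run , residue ⟩
      with-residue = ≈-trans ⟨⟩∘ (≈-trans (⟨⟩-cong run-succ residue-succ) (≈-sym joint∘))
      with-zero : ⟨ run , false ⟩ ∘ σₛ ≈ joint ∘ ⟨ run , false ⟩
      with-zero = ≈-trans ⟨⟩∘ (≈-trans (⟨⟩-cong run-succ const-∘)
                    (≈-sym (≈-trans joint∘ (⟨⟩-congʳ mul-zeroʳ))))
      at-start : ⟨ run , residue ⟩ ∘ σ₀ ≈ ⟨ run , false ⟩ ∘ σ₀
      at-start = ≈-trans ⟨⟩∘ (≈-trans (⟨⟩-congʳ (≈-trans app-∘ (≈-trans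
                   (argʳ-cong (≈-trans app-∘ (≈-trans (argˡ-cong π₂-β) monus-zeroˡ))) mul-zeroʳ)))
                   (≈-sym (≈-trans ⟨⟩∘ (⟨⟩-congʳ const-∘))))

  common-part : ∀ {Γ} (a b : Hom Γ ℕo) →
                Σ (Hom Γ ℕo) λ c → add ∘ ⟨ monus ∘ ⟨ a , b ⟩ , c ⟩ ≈ a
                                 × add ∘ ⟨ monus ∘ ⟨ b , a ⟩ , c ⟩ ≈ b
  common-part {Γ} a b = c , ≈-trans (argˡ-cong (≈-sym p-final)) p+c
                          , ≈-trans (argˡ-cong (≈-sym q-final)) q+c
    where
    final : Hom Γ State
    final = run ∘ ⟨ ⟨ a , b ⟩ , a ⟩
    open At final
    from-start : ∀ {I : Hom State ℕo} → I ∘ step ≈ I → I ∘ final ≈ I ∘ ⟨ ⟨ a , b ⟩ , false ⟩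
    from-start h = ≈-trans sym-assoc (≈-trans (∘-congˡ (run-invariant h))
                     (≈-trans assoc (≈-trans (∘-congʳ π₁-β) (≈-trans assoc (∘-congʳ σ₀∘)))))
    p+c : add ∘ ⟨ p , c ⟩ ≈ a
    p+c = ≈-trans (≈-sym app-∘) (≈-trans (from-start invariant-p+c)
            (≈-trans app-∘ (≈-trans (arg-cong P-at π₂-β) add-zeroʳ)))
    q+c : add ∘ ⟨ q , c ⟩ ≈ b
    q+c = ≈-trans (≈-sym app-∘) (≈-trans (from-start invariant-q+c)
            (≈-trans app-∘ (≈-trans (arg-cong Q-at π₂-β) add-zeroʳ)))
    p∸q : monus ∘ ⟨ p , q ⟩ ≈ monus ∘ ⟨ a , b ⟩
    p∸q = ≈-trans (≈-sym app-∘) (≈-trans (from-start invariant-p∸q) (≈-trans app-∘ (arg-cong P-at Q-at)))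
    q∸p : monus ∘ ⟨ q , p ⟩ ≈ monus ∘ ⟨ b , a ⟩
    q∸p = ≈-trans (≈-sym app-∘) (≈-trans (from-start invariant-q∸p) (≈-trans app-∘ (arg-cong Q-at P-at)))
    -- The residue after a steps is g · (a ∸ c) = g · p.
    g·p≈0 : mul ∘ ⟨ g , p ⟩ ≈ false
    g·p≈0 = begin
      mul ∘ ⟨ g , p ⟩
        ≈⟨ arg-cong g-at (≈-trans (argˡ-cong (≈-sym p+c)) monus-add) ⟨
      mul ∘ ⟨ G ∘ final , monus ∘ ⟨ a , c ⟩ ⟩
        ≈⟨ arg-cong assoc (≈-trans app-∘ (arg-cong π₂-β assoc)) ⟨
      mul ∘ ⟨ (G ∘ run) ∘ ⟨ ⟨ a , b ⟩ , a ⟩ , (monus ∘ ⟨ π₂ , C ∘ run ⟩) ∘ ⟨ ⟨ a , b ⟩ , a ⟩ ⟩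
        ≈⟨ app-∘ ⟨
      residue ∘ ⟨ ⟨ a , b ⟩ , a ⟩
        ≈⟨ ∘-congˡ residue≈0 ⟩
      false ∘ ⟨ ⟨ a , b ⟩ , a ⟩
        ≈⟨ const-∘ ⟩
      false ∎
    cancel : ∀ {x : Hom Γ ℕo} → mul ∘ ⟨ x , sign ∘ (mul ∘ ⟨ g , p ⟩) ⟩ ≈ false
    cancel = ≈-trans (argʳ-cong (≈-trans (∘-congʳ g·p≈0) sign-zero)) mul-zeroʳ
    p-final : p ≈ monus ∘ ⟨ a , b ⟩
    p-final = ≈-trans (≈-sym (≈-trans (argʳ-cong cancel) monus-zeroʳ))
                (≈-trans (exhausted-p ! (env p q false false)) p∸q)
    q-final : q ≈ monus ∘ ⟨ b , a ⟩
    q-final = ≈-trans (≈-sym (≈-trans (argʳ-cong cancel) monus-zeroʳ))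
                (≈-trans (exhausted-q ! (env p q false false)) q∸p)

open CommonPart using (common-part)

eq-ℕ-unfold : ∀ {Γ} {m m' : Hom Γ ℕo} →
              eq ℕo ∘ ⟨ m , m' ⟩ ≈ and ∘ ⟨ neg ∘ (monus ∘ ⟨ m , m' ⟩) , neg ∘ (monus ∘ ⟨ m' , m ⟩) ⟩
eq-ℕ-unfold = ≈-trans app-∘ (arg-cong assoc (≈-trans assoc (∘-congʳ (≈-trans app-∘ (arg-cong π₂-β π₁-β)))))

-- Writing m = x + c, m' = y + c
-- with c the common part, x = m ∸ m', y = m' ∸ m, it suffices that
--   (¬x ∧ ¬y) ⇒ R(d, x + c, y + c)
-- holds for all x, y, c, which follows by case analysis on x and y.
leibniz-ℕ : ∀ {Δ} (R : Hom (Δ ⊗ (ℕo ⊗ ℕo)) ℕo) → R ∘ ⟨ π₁ , ⟨ π₂ , π₂ ⟩ ⟩ ≈ true →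
            ∀ {Γ} (d : Hom Γ Δ) (m m' : Hom Γ ℕo) → eq ℕo ∘ ⟨ m , m' ⟩ ⊑ R ∘ ⟨ d , ⟨ m , m' ⟩ ⟩
leibniz-ℕ {Δ} R diagonal d m m' =
  let (c , x+c≈m , y+c≈m') = common-part m m' in
  ≈-trans (arg-cong eq-ℕ-unfold (argʳ-cong (⟨⟩-cong (≈-sym x+c≈m) (≈-sym y+c≈m'))))
          (shifted d (env (monus ∘ ⟨ m , m' ⟩) (monus ∘ ⟨ m' , m ⟩) c))
  where
  open Terms Δ
  x y c : Term 3
  x = var fz
  y = var (fs fz)
  c = var (fs (fs fz))
  env : ∀ {Γ} → Hom Γ ℕo → Hom Γ ℕo → Hom Γ ℕo → Env Γ 3
  env x y c fz           = x
  env x y c (fs fz)      = y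
  env x y c (fs (fs fz)) = c
  on-diagonal : ∀ {Γ} {δ : Hom Γ Δ} {n : Hom Γ ℕo} → R ∘ ⟨ δ , ⟨ n , n ⟩ ⟩ ≈ true
  on-diagonal = ≈-trans (∘-congʳ (≈-sym (≈-trans ⟨⟩∘
                  (⟨⟩-cong π₁-β (≈-trans ⟨⟩∘ (⟨⟩-cong π₂-β π₂-β))))))
                  (≈-trans sym-assoc (≈-trans (∘-congˡ diagonal) const-∘))
  shifted : (¬ᵗ x ∧ᵗ ¬ᵗ y) ⇒ᵗ app R (x +ᵗ c) (y +ᵗ c) ≋ oneᵗ
  shifted = by-cases-on fz ((¬ᵗ x ∧ᵗ ¬ᵗ y) ⇒ᵗ app R (x +ᵗ c) (y +ᵗ c)) oneᵗ
    (by-cases-on (fs fz) (((¬ᵗ x ∧ᵗ ¬ᵗ y) ⇒ᵗ app R (x +ᵗ c) (y +ᵗ c)) [ fz ≔ zeroᵗ ]) oneᵗ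
      (λ δ ρ → ≈-trans (arg-cong (≈-trans (arg-cong neg-zero neg-zero) (Propositional.and-table tt tt))
                                         (≈-trans (argʳ-cong (⟨⟩-cong add-zeroˡ add-zeroˡ)) on-diagonal))
                       (≈-trans imp-true sign-true))
      (λ δ ρ → ≈-trans (argˡ-cong (≈-trans (arg-cong neg-zero neg-succ) and-zeroʳ)) imp-false))
    (λ δ ρ → ≈-trans (argˡ-cong (≈-trans (argˡ-cong neg-succ) and-zeroˡ)) imp-false)

-- A map with  d(x, 0) = 0  and  d(x, s n) = d(x, s n) · d(x, n)  vanishes:
-- ⟨id, d⟩ and ⟨id, 0⟩ obey the same recursion step.
vanishing : ∀ {X} (d : Hom (X ⊗ ℕo) ℕo) →
            d ∘ σ₀ ≈ false → d ∘ σₛ ≈ mul ∘ ⟨ d ∘ σₛ , d ⟩ → d ≈ false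
vanishing {X} d d₀ dₛ = ≈-trans (≈-sym π₂-β) (≈-trans (∘-congʳ graphs) π₂-β)
  where
  step : Hom ((X ⊗ ℕo) ⊗ ℕo) ((X ⊗ ℕo) ⊗ ℕo)
  step = ⟨ σₛ ∘ π₁ , mul ∘ ⟨ d ∘ (σₛ ∘ π₁) , π₂ ⟩ ⟩
  step∘ : ∀ {y : Hom (X ⊗ ℕo) ℕo} → step ∘ ⟨ id , y ⟩ ≈ ⟨ σₛ , mul ∘ ⟨ d ∘ σₛ , y ⟩ ⟩
  step∘ = ≈-trans ⟨⟩∘ (⟨⟩-cong (≈-trans ∘π₁-β idʳ)
            (≈-trans app-∘ (arg-cong (≈-trans assoc (∘-congʳ (≈-trans ∘π₁-β idʳ))) π₂-β)))
  graphs : ⟨ id , d ⟩ ≈ ⟨ id , false ⟩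
  graphs = iter-unique
    (≈-trans ⟨⟩∘ (≈-trans (⟨⟩-cong (≈-trans idˡ (≈-sym idʳ)) dₛ)
                          (≈-sym (≈-trans step∘ (⟨⟩-congˡ (≈-sym idʳ))))))
    (≈-trans ⟨⟩∘ (≈-trans (⟨⟩-cong (≈-trans idˡ (≈-sym idʳ)) const-∘)
                          (≈-sym (≈-trans step∘ (⟨⟩-cong (≈-sym idʳ) mul-zeroʳ)))))
    (≈-trans ⟨⟩∘ (≈-trans (⟨⟩-congʳ d₀) (≈-sym (≈-trans ⟨⟩∘ (⟨⟩-congʳ const-∘)))))

-- Its negation d = ¬φ vanishes, since ¬q = ¬q · ¬p whenever
-- p ⇒ q, by the identity  ¬q = ¬q · ¬p + ¬q · ¬(p ⇒ q).
induction : ∀ {X} (φ : Hom (X ⊗ ℕo) ℕo) → Boolean φ → φ ∘ σ₀ ≈ true → φ ⊑ φ ∘ σₛ → φ ≈ true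
induction {X} φ bφ φ₀ φₛ = begin
  φ                ≈⟨ bφ ⟨
  sign ∘ φ         ≈⟨ assoc ⟩
  neg ∘ (neg ∘ φ)  ≈⟨ ∘-congʳ (vanishing (neg ∘ φ) d₀ dₛ) ⟩
  neg ∘ false      ≈⟨ neg-zero ⟩
  true             ∎
  where
  open Terms 𝟙
  p q : Term 2
  p = var fz
  q = var (fs fz)
  env : Hom (X ⊗ ℕo) ℕo → Hom (X ⊗ ℕo) ℕo → Env (X ⊗ ℕo) 2
  env p q fz      = p
  env p q (fs fz) = q
  rhs : Term 2
  rhs = (¬ᵗ q ·ᵗ ¬ᵗ p) +ᵗ (¬ᵗ q ·ᵗ ¬ᵗ (p ⇒ᵗ q))
  imp-succ-zero : ∀ {Γ} {x : Hom Γ ℕo} → imp ∘ ⟨ succ ∘ x , false ⟩ ≈ false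
  imp-succ-zero = ≈-trans imp-unfold (≈-trans (argˡ-cong neg-succ) or-zero-zero)
  split : ¬ᵗ q ≋ rhs
  split = by-cases-on (fs fz) (¬ᵗ q) rhs
    (by-cases-on fz (¬ᵗ q [ fs fz ≔ zeroᵗ ]) (rhs [ fs fz ≔ zeroᵗ ])
      (λ δ ρ → ≈-trans neg-zero (≈-sym (≈-trans (arg-cong
        (≈-trans (arg-cong neg-zero neg-zero) mul-oneˡ)
        (≈-trans (arg-cong neg-zero (≈-trans (∘-congʳ imp-false) neg-true)) mul-zeroʳ)) add-zeroʳ)))
      (λ δ ρ → ≈-trans neg-zero (≈-sym (≈-trans (arg-cong
        (≈-trans (arg-cong neg-zero neg-succ) mul-zeroʳ)
        (≈-trans (arg-cong neg-zero (≈-trans (∘-congʳ imp-succ-zero) neg-zero)) mul-oneˡ)) add-zeroˡ))))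
    (λ δ ρ → ≈-trans neg-succ (≈-sym (≈-trans (arg-cong (≈-trans (argˡ-cong neg-succ) mul-zeroˡ)
                                                         (≈-trans (argˡ-cong neg-succ) mul-zeroˡ)) add-zeroʳ)))
  d₀ : (neg ∘ φ) ∘ σ₀ ≈ false
  d₀ = ≈-trans assoc (≈-trans (∘-congʳ φ₀) neg-true)
  dₛ : (neg ∘ φ) ∘ σₛ ≈ mul ∘ ⟨ (neg ∘ φ) ∘ σₛ , neg ∘ φ ⟩
  dₛ = ≈-trans assoc (≈-trans (split ! (env φ (φ ∘ σₛ)))
         (≈-trans (argʳ-cong (≈-trans (argʳ-cong (≈-trans (∘-congʳ φₛ) neg-true)) mul-zeroʳ))
           (≈-trans add-zeroʳ (argˡ-cong sym-assoc))))

eq-boolean : ∀ A → Boolean (eq A)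
eq-boolean 𝟙       = sign-true
eq-boolean ℕo      = boolean-and
eq-boolean (A ⊗ B) = boolean-and

eq-boolean-at : ∀ {A Γ} {σ : Hom Γ (A ⊗ A)} → Boolean (eq A ∘ σ)
eq-boolean-at {A} = boolean-∘ (eq-boolean A)

Respects : ∀ {A B} → Hom A B → Set
Respects {A} {B} f = eq A ⊑ eq B ∘ (f ×₁ f)

respects-at : ∀ {A B Γ} {g : Hom A B} → Respects g → (u u' : Hom Γ A) →
              eq A ∘ ⟨ u , u' ⟩ ⊑ eq B ∘ ⟨ g ∘ u , g ∘ u' ⟩
respects-at r u u' = ⊑-congʳ (≈-trans assoc (∘-congʳ ×₁-∘⟨⟩)) (⊑-∘ ⟨ u , u' ⟩ r)

respects-id : ∀ {A} → Respects (id {A})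
respects-id {A} = ⊑-congʳ (≈-sym (≈-trans (∘-congʳ (≈-trans (⟨⟩-cong idˡ idˡ) ⟨π₁,π₂⟩≈id)) idʳ))
                    (⊑-refl (eq-boolean A))

respects-∘ : ∀ {A B C} {g : Hom B C} {h : Hom A B} → Respects g → Respects h → Respects (g ∘ h)
respects-∘ {A} {g = g} {h} rg rh = ⊑-trans (eq-boolean A) eq-boolean-at eq-boolean-at rh
  (⊑-congʳ (≈-trans assoc (∘-congʳ (≈-trans ×₁-∘⟨⟩ (⟨⟩-cong sym-assoc sym-assoc)))) (⊑-∘ (h ×₁ h) rg))

respects-! : ∀ {A} → Respects (! {A})
respects-! = ⊑-congʳ (≈-sym const-∘) ⊑-true

respects-π₁ : ∀ {A B} → Respects (π₁ {A} {B})
respects-π₁ = ⊑-∧-elimˡ eq-boolean-at eq-boolean-at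

respects-π₂ : ∀ {A B} → Respects (π₂ {A} {B})
respects-π₂ = ⊑-∧-elimʳ eq-boolean-at eq-boolean-at

respects-⟨⟩ : ∀ {A B C} {g : Hom C A} {h : Hom C B} → Respects g → Respects h → Respects ⟨ g , h ⟩
respects-⟨⟩ {A} {B} {C} {g} {h} rg rh =
  ⊑-congʳ (≈-sym eq-pair) (⊑-∧-intro (eq-boolean C) eq-boolean-at eq-boolean-at rg rh)
  where
  eq-pair : eq (A ⊗ B) ∘ (⟨ g , h ⟩ ×₁ ⟨ g , h ⟩) ≈ and ∘ ⟨ eq A ∘ (g ×₁ g) , eq B ∘ (h ×₁ h) ⟩
  eq-pair = ≈-trans app-∘ (∘-congʳ (⟨⟩-cong
    (≈-trans assoc (∘-congʳ (≈-trans ⟨⟩∘ (⟨⟩-cong (≈-trans assoc (≈-trans (∘-congʳ π₁-β) π₁-β∘))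
                                                  (≈-trans assoc (≈-trans (∘-congʳ π₂-β) π₁-β∘))))))
    (≈-trans assoc (∘-congʳ (≈-trans ⟨⟩∘ (⟨⟩-cong (≈-trans assoc (≈-trans (∘-congʳ π₁-β) π₂-β∘))
                                                  (≈-trans assoc (≈-trans (∘-congʳ π₂-β) π₂-β∘))))))))

respects-zero : Respects zero
respects-zero = ⊑-congʳ (≈-sym eq-zero) ⊑-true
  where
  zero-const : ∀ {h : Hom (𝟙 ⊗ 𝟙) 𝟙} → zero ∘ h ≈ false
  zero-const = ∘-congʳ (≈-trans !-unique (≈-sym !-unique))
  eq-zero : eq ℕo ∘ (zero ×₁ zero) ≈ true
  eq-zero = ≈-trans eq-ℕ-unfold (≈-trans (∘-congʳ (⟨⟩-cong
    (∘-congʳ (≈-trans (arg-cong zero-const zero-const) monus-zeroʳ))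
    (∘-congʳ (≈-trans (arg-cong zero-const zero-const) monus-zeroʳ))))
    (≈-trans (arg-cong neg-zero neg-zero) (Propositional.and-table tt tt)))

respects-succ : Respects succ
respects-succ = ⊑-congʳ (≈-sym eq-succ) (⊑-refl (eq-boolean ℕo))
  where
  eq-succ : eq ℕo ∘ (succ ×₁ succ) ≈ eq ℕo
  eq-succ = ≈-trans eq-ℕ-unfold (≈-trans (arg-cong (∘-congʳ monus-succ-succ) (∘-congʳ monus-succ-succ))
              (≈-trans (≈-sym eq-ℕ-unfold) (≈-trans (∘-congʳ ⟨π₁,π₂⟩≈id) idʳ)))

respects-iter-fixed : ∀ {A} {g : Hom A A} → Respects g → ∀ {Γ} (a a' : Hom Γ A) (m : Hom Γ ℕo) →
                      eq A ∘ ⟨ a , a' ⟩ ⊑ eq A ∘ ⟨ iter g ∘ ⟨ a , m ⟩ , iter g ∘ ⟨ a' , m ⟩ ⟩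
respects-iter-fixed {A} {g} rg a a' m = begin
  imp ∘ ⟨ eq A ∘ ⟨ a , a' ⟩ , eq A ∘ ⟨ F ∘ ⟨ a , m ⟩ , F ∘ ⟨ a' , m ⟩ ⟩ ⟩
    ≈⟨ ≈-trans app-∘ (arg-cong ∘π₁-β (≈-trans app-∘ (∘-congʳ (⟨⟩-cong
          (≈-trans app-∘ (arg-cong (≈-trans assoc (≈-trans (∘-congʳ π₁-β) π₁-β)) π₂-β))
          (≈-trans app-∘ (arg-cong (≈-trans assoc (≈-trans (∘-congʳ π₁-β) π₂-β)) π₂-β)))))) ⟨
  φ ∘ ⟨ ⟨ a , a' ⟩ , m ⟩     ≈⟨ ∘-congˡ φ-true ⟩
  true ∘ ⟨ ⟨ a , a' ⟩ , m ⟩  ≈⟨ const-∘ ⟩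
  true                       ∎
  where
  F : Hom (A ⊗ ℕo) A
  F = iter g
  F-at : Hom (A ⊗ A) A → Hom ((A ⊗ A) ⊗ ℕo) A
  F-at x = F ∘ ⟨ x ∘ π₁ , π₂ ⟩
  φ : Hom ((A ⊗ A) ⊗ ℕo) ℕo
  φ = imp ∘ ⟨ eq A ∘ π₁ , eq A ∘ ⟨ F-at π₁ , F-at π₂ ⟩ ⟩
  F-at-zero : ∀ {x : Hom (A ⊗ A) A} → F-at x ∘ σ₀ ≈ x
  F-at-zero = ≈-trans app-∘ (≈-trans (arg-cong (≈-trans assoc (≈-trans (∘-congʳ π₁-β) idʳ)) π₂-β) iter-β₀)
  F-at-succ : ∀ {x : Hom (A ⊗ A) A} → F-at x ∘ σₛ ≈ g ∘ F-at x
  F-at-succ = ≈-trans app-∘ (≈-trans (arg-cong (≈-trans assoc (∘-congʳ π₁-β)) π₂-β) iter-βₛ)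
  φ-zero : φ ∘ σ₀ ≈ true
  φ-zero = ≈-trans app-∘ (≈-trans (arg-cong (≈-trans assoc (≈-trans (∘-congʳ π₁-β) idʳ))
             (≈-trans app-∘ (≈-trans (arg-cong F-at-zero F-at-zero) (≈-trans (∘-congʳ ⟨π₁,π₂⟩≈id) idʳ))))
           (⊑-refl (eq-boolean A)))
  φ-succ : φ ⊑ φ ∘ σₛ
  φ-succ = ⊑-congʳ (≈-sym φ∘σₛ) (⊑-⇒-mono (boolean-∘ (eq-boolean A)) eq-boolean-at eq-boolean-at
             (respects-at rg (F-at π₁) (F-at π₂)))
    where
    φ∘σₛ : φ ∘ σₛ ≈ imp ∘ ⟨ eq A ∘ π₁ , eq A ∘ ⟨ g ∘ F-at π₁ , g ∘ F-at π₂ ⟩ ⟩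
    φ∘σₛ = ≈-trans app-∘ (arg-cong ∘π₁-β (≈-trans app-∘ (arg-cong F-at-succ F-at-succ)))
  φ-true : φ ≈ true
  φ-true = induction φ boolean-imp φ-zero φ-succ

-- Iterates respect equality: with [a ≐ a'] ⇒ [F(a, n) ≐ F(a', n')] as
-- the relation R(d, n, n') on d = ((a, n), (a', n')), Leibniz's law
-- reduces the claim to the fixed-count case on the diagonal.
respects-iter : ∀ {A} {g : Hom A A} → Respects g → Respects (iter g)
respects-iter {A} {g} rg =
  ⊑-congʳ (arg-cong (∘-congʳ ⟨⟩-η) (∘-congʳ ⟨⟩-η))
          (⊑-uncurry eq-boolean-at eq-boolean-at eq-boolean-at count-step)
  where
  F : Hom (A ⊗ ℕo) A
  F = iter g
  D : Obj
  D = (A ⊗ ℕo) ⊗ (A ⊗ ℕo)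
  a a' : Hom D A
  a  = π₁ ∘ π₁
  a' = π₁ ∘ π₂
  n n' : Hom D ℕo
  n  = π₂ ∘ π₁
  n' = π₂ ∘ π₂
  R : Hom (D ⊗ (ℕo ⊗ ℕo)) ℕo
  R = imp ∘ ⟨ (eq A ∘ ⟨ a , a' ⟩) ∘ π₁ ,
              eq A ∘ ⟨ F ∘ ⟨ a ∘ π₁ , π₁ ∘ π₂ ⟩ , F ∘ ⟨ a' ∘ π₁ , π₂ ∘ π₂ ⟩ ⟩ ⟩
  R-at : ∀ {Γ} {d : Hom Γ D} {x y : Hom Γ ℕo} → R ∘ ⟨ d , ⟨ x , y ⟩ ⟩ ≈
         imp ∘ ⟨ eq A ∘ ⟨ a ∘ d , a' ∘ d ⟩ , eq A ∘ ⟨ F ∘ ⟨ a ∘ d , x ⟩ , F ∘ ⟨ a' ∘ d , y ⟩ ⟩ ⟩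
  R-at = ≈-trans app-∘ (arg-cong (≈-trans ∘π₁-β app-∘) (≈-trans app-∘ (∘-congʳ (⟨⟩-cong
           (≈-trans app-∘ (arg-cong ∘π₁-β (≈-trans assoc (≈-trans (∘-congʳ π₂-β) π₁-β))))
           (≈-trans app-∘ (arg-cong ∘π₁-β (≈-trans assoc (≈-trans (∘-congʳ π₂-β) π₂-β))))))))
  diagonal : R ∘ ⟨ π₁ , ⟨ π₂ , π₂ ⟩ ⟩ ≈ true
  diagonal = ≈-trans R-at (respects-iter-fixed rg (a ∘ π₁) (a' ∘ π₁) π₂)
  count-step : eq ℕo ∘ ⟨ n , n' ⟩ ⊑
               imp ∘ ⟨ eq A ∘ ⟨ a , a' ⟩ , eq A ∘ ⟨ F ∘ ⟨ a , n ⟩ , F ∘ ⟨ a' , n' ⟩ ⟩ ⟩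
  count-step = ⊑-congʳ (≈-trans R-at (arg-cong (arg-cong idʳ idʳ)
                                              (arg-cong (argˡ-cong idʳ) (argˡ-cong idʳ))))
                 (leibniz-ℕ R diagonal id n n')

mainTheorem2 : ∀ {A B} (f : Hom A B) →
    imp ∘ ⟨ eq A , eq B ∘ (f ×₁ f) ⟩ ≈ true
mainTheorem2 id       = respects-id
mainTheorem2 (g ∘ h)  = respects-∘ (mainTheorem2 g) (mainTheorem2 h)
mainTheorem2 !        = respects-!
mainTheorem2 π₁       = respects-π₁
mainTheorem2 π₂       = respects-π₂
mainTheorem2 ⟨ g , h ⟩ = respects-⟨⟩ (mainTheorem2 g) (mainTheorem2 h)
mainTheorem2 zero     = respects-zero
mainTheorem2 succ     = respects-succ
mainTheorem2 (iter g) = respects-iter (mainTheorem2 g)
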